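{- Let $S$ be a starlike tree with $n$ vertices and $\ell$ leaves, with central vertex $v_0$, and label the vertices of the $i$-th tentacle ($1\le i\le\ell$) as $v_{i,1},\dots,v_{i,n_i}$, where $v_{i,1}$ is adjacent to $v_0$, $v_{i,j}\sim v_{i,j+1}$, and $v_{i,n_i}$ is a leaf. Let $(\mathbf{d},\mathbf{r})$ be an arithmetical structure on $S$, let $r_0=\mathbf{r}(v_0)$, $d_0=\mathbf{d}(v_0)$, $r_{i,j}=\mathbf{r}(v_{i,j})$, and set $d^*_i=r_0/r_{i,n_i}$ and $e_i=r_{i,1}/r_{i,n_i}$ for $i\in\{1,\dots,\ell\}$. Define the $(\ell+1)\times(\ell+1)$ matrix \[L^*(S,\mathbf{d})=\begin{bmatrix} d^*_1 & & & & -e_1\\ & d^*_2 & & & -e_2\\ & & \ddots & & \vdots\\ & & & d^*_\ell & -e_\ell\\ -1 & -1 & \cdots & -1 & d_0\end{bmatrix}\] (blank entries $0$). Then, under integer row and column operations, $L(S,\mathbf{d})=\operatorname{diag}(\mathbf{d})-A(S)$ is equivalent to $L^*(S,\mathbf{d})\oplus I_{n-\ell-1}$.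
   Context: A starlike tree is a tree with exactly one vertex $v_0$ of degree at least $3$ (its central vertex); removing $v_0$ leaves $\ell$ paths (the tentacles), each containing exactly one leaf of $S$ and one neighbor of $v_0$. An arithmetical structure on $S$ is a pair $(\mathbf{d},\mathbf{r})$ with $\mathbf{d}\in\mathbb{Z}_{\ge0}^{V(S)}$, $\mathbf{r}\in\mathbb{Z}_{>0}^{V(S)}$ whose entries have no nontrivial common factor, and $(\operatorname{diag}(\mathbf{d})-A(S))\mathbf{r}=\mathbf{0}$, where $A(S)$ is the adjacency matrix. -}

module Defs where

open import Data.Nat as ℕ using (ℕ; zero; suc; _<_; NonZero; >-nonZero)
open import Data.Nat.DivMod using (_/_)
open import Data.Nat.Divisibility using (_∣_)
open import Data.Integer as ℤ using (ℤ; +_; 0ℤ; 1ℤ; -_; _-_)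
open import Data.Fin as Fin using (Fin; toℕ)
open import Data.Fin.Properties using () renaming (_≟_ to _≟F_)
open import Data.List using (List; []; _∷_; map; concatMap; allFin; foldr; _++_)
open import Data.Sum using (_⊎_; inj₁; inj₂)
open import Data.Sum.Properties using (≡-dec)
open import Data.Unit using (⊤; tt)
open import Data.Unit.Properties using () renaming (_≟_ to _≟⊤_)
open import Data.Product using (Σ; Σ-syntax; _×_; _,_)
open import Relation.Nullary using (Dec; yes; no; ¬_)
open import Relation.Nullary.Decidable using (⌊_⌋)
open import Relation.Binary.PropositionalEquality using (_≡_; refl; cong)
open import Relation.Binary.Definitions using (DecidableEquality)
open import Data.Bool using (Bool; true; false; if_then_else_; _∧_; _∨_)

-- Generic integer matrices indexed by finite types (given by an
-- enumeration list of all their elements, each exactly once).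

Mat : Set → Set → Set
Mat A B = A → B → ℤ

ΣL : {A : Set} → List A → (A → ℤ) → ℤ
ΣL xs f = foldr (λ x acc → f x ℤ.+ acc) 0ℤ xs

mul : {A B C : Set} → List B → Mat A B → Mat B C → Mat A C
mul es M N a c = ΣL es (λ b → M a b ℤ.* N b c)

idM : {A : Set} → DecidableEquality A → Mat A A
idM dec a b with dec a b
... | yes _ = 1ℤ
... | no  _ = 0ℤ

diagM : {A : Set} → DecidableEquality A → (A → ℤ) → Mat A A
diagM dec f a b = idM dec a b ℤ.* f a

_≐_ : {A B : Set} → Mat A B → Mat A B → Set
M ≐ N = ∀ a b → M a b ≡ N a b

-- M (indexed by A, enumerated by eA) and N (indexed by B, enumerated by eB)
-- are equivalent under integer row and column operations:
-- P · M · Q = N with P, Q invertible over ℤ (unimodular).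
EquivZ : {A B : Set} (eA : List A) (eB : List B)
         (dA : DecidableEquality A) (dB : DecidableEquality B) →
         Mat A A → Mat B B → Set
EquivZ {A} {B} eA eB dA dB M N =
  Σ[ P ∈ Mat B A ] Σ[ P′ ∈ Mat A B ] Σ[ Q ∈ Mat A B ] Σ[ Q′ ∈ Mat B A ]
    (mul eA P P′ ≐ idM dB) × (mul eB P′ P ≐ idM dA) ×
    (mul eB Q Q′ ≐ idM dA) × (mul eA Q′ Q ≐ idM dB) ×
    (mul eA (mul eA P M) Q ≐ N)

-- The starlike tree with ℓ tentacles, tentacle i having n_i = suc (m i)
-- vertices.  Vertex  tent i j  (j : Fin n_i) is v_{i, j+1}.

data Vtx (ℓ : ℕ) (m : Fin ℓ → ℕ) : Set where
  center : Vtx ℓ m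
  tent   : (i : Fin ℓ) → Fin (suc (m i)) → Vtx ℓ m

module _ {ℓ : ℕ} {m : Fin ℓ → ℕ} where

  tent-inj : ∀ {i i′ j j′} → tent {ℓ} {m} i j ≡ tent i′ j′ → Σ (i ≡ i′) λ { refl → j ≡ j′ }
  tent-inj refl = refl , refl

  _≟V_ : DecidableEquality (Vtx ℓ m)
  center ≟V center = yes refl
  center ≟V tent _ _ = no λ ()
  tent _ _ ≟V center = no λ ()
  tent i j ≟V tent i′ j′ with i ≟F i′
  ... | no ¬p = no λ e → ¬p (Data.Product.proj₁ (tent-inj e))
  ... | yes refl with j ≟F j′
  ...   | yes refl = yes refl
  ...   | no ¬q = no λ e → ¬q (lem e)
    where
      lem : ∀ {j₁ j₂} → tent {ℓ} {m} i j₁ ≡ tent i j₂ → j₁ ≡ j₂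
      lem refl = refl

allVtx : (ℓ : ℕ) (m : Fin ℓ → ℕ) → List (Vtx ℓ m)
allVtx ℓ m = center ∷ concatMap (λ i → map (tent i) (allFin (suc (m i)))) (allFin ℓ)

nVtx : (ℓ : ℕ) (m : Fin ℓ → ℕ) → ℕ
nVtx ℓ m = suc (foldr ℕ._+_ 0 (map (λ i → suc (m i)) (allFin ℓ)))

b2z : Bool → ℤ
b2z true  = 1ℤ
b2z false = 0ℤ

adjB : {ℓ : ℕ} {m : Fin ℓ → ℕ} → Vtx ℓ m → Vtx ℓ m → Bool
adjB center center = false
adjB center (tent i j) = ⌊ toℕ j ℕ.≟ 0 ⌋
adjB (tent i j) center = ⌊ toℕ j ℕ.≟ 0 ⌋
adjB (tent i j) (tent i′ j′) =
  ⌊ i ≟F i′ ⌋ ∧ (⌊ suc (toℕ j) ℕ.≟ toℕ j′ ⌋ ∨ ⌊ suc (toℕ j′) ℕ.≟ toℕ j ⌋)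

adjM : (ℓ : ℕ) (m : Fin ℓ → ℕ) → Mat (Vtx ℓ m) (Vtx ℓ m)
adjM ℓ m v u = b2z (adjB v u)

LapM : (ℓ : ℕ) (m : Fin ℓ → ℕ) → (Vtx ℓ m → ℕ) → Mat (Vtx ℓ m) (Vtx ℓ m)
LapM ℓ m d v u = diagM _≟V_ (λ w → + d w) v u - adjM ℓ m v u

record IsArithStructure (ℓ : ℕ) (m : Fin ℓ → ℕ) (d r : Vtx ℓ m → ℕ) : Set where
  field
    r-pos    : ∀ v → 0 < r v
    r-prim   : ∀ k → (∀ v → k ∣ r v) → k ≡ 1
    kernel   : ∀ v → ΣL (allVtx ℓ m) (λ u → LapM ℓ m d v u ℤ.* + r u) ≡ 0ℤ

-- The reduced matrix L*(S,d), indexed by Fin ℓ ⊎ ⊤ (inj₂ tt = v0 row/col).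

firstV lastV : {ℓ : ℕ} {m : Fin ℓ → ℕ} → Fin ℓ → Vtx ℓ m
firstV i = tent i Fin.zero
lastV {m = m} i = tent i (Fin.fromℕ (m i))

Lstar : (ℓ : ℕ) (m : Fin ℓ → ℕ) (d r : Vtx ℓ m → ℕ) → (∀ v → 0 < r v) →
        Mat (Fin ℓ ⊎ ⊤) (Fin ℓ ⊎ ⊤)
Lstar ℓ m d r rpos (inj₁ i) (inj₁ i′) with i ≟F i′
... | yes _ = + (_/_ (r center) (r (lastV i)) {{>-nonZero (rpos (lastV i))}})
... | no  _ = 0ℤ
Lstar ℓ m d r rpos (inj₁ i) (inj₂ _) =
  - + (_/_ (r (firstV i)) (r (lastV i)) {{>-nonZero (rpos (lastV i))}})
Lstar ℓ m d r rpos (inj₂ _) (inj₁ _) = - 1ℤ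
Lstar ℓ m d r rpos (inj₂ _) (inj₂ _) = + d center

⊕I : {A : Set} → DecidableEquality A → Mat A A → (k : ℕ) → Mat (A ⊎ Fin k) (A ⊎ Fin k)
⊕I dA M k (inj₁ a) (inj₁ b) = M a b
⊕I dA M k (inj₁ a) (inj₂ b) = 0ℤ
⊕I dA M k (inj₂ a) (inj₁ b) = 0ℤ
⊕I dA M k (inj₂ a) (inj₂ b) = idM _≟F_ a b

decStar : (ℓ : ℕ) → DecidableEquality (Fin ℓ ⊎ ⊤)
decStar ℓ = ≡-dec _≟F_ _≟⊤_

decT : (ℓ k : ℕ) → DecidableEquality ((Fin ℓ ⊎ ⊤) ⊎ Fin k)
decT ℓ k = ≡-dec (decStar ℓ) _≟F_

enumT : (ℓ k : ℕ) → List ((Fin ℓ ⊎ ⊤) ⊎ Fin k)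
enumT ℓ k = map inj₁ (map inj₁ (allFin ℓ) ++ (inj₂ tt ∷ [])) ++ map inj₂ (allFin k)

-- Let ρᵢ be the value of r at the leaf of tentacle i.  Read from the leaf towards v₀, the kernel
-- equations d_j r_j = r_{j-1} + r_{j+1} along the tentacle show that ρᵢ divides r at every vertex of
-- the tentacle and at v₀.  So a unimodular row operation may replace the row of the leaf by the
-- combination of the rows of its tentacle with coefficients r_y / ρᵢ; since L is symmetric and
-- L r = 0, that combination is -e_i at v₀ and d*_i at v_{i,1}, and 0 elsewhere.  Every other vertex
-- v_{i,j} of a tentacle has the entry -1 at its successor v_{i,j+1}, so a column operation Q, defined
-- by the three-term recurrence of the path and with an explicit inverse, turns its row into
-- -e_{v_{i,j+1}} while fixing the rows supported on v₀ and its neighbours.  Relabelling rows and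
-- columns and negating the rows of the identity block then gives L*(S, d) ⊕ I.
module Submission where

open import Data.Bool using (_∧_; _∨_)
open import Data.Bool.Properties using (∨-comm)
open import Data.Empty using (⊥-elim)
open import Data.Fin as Fin using (Fin; zero; suc; toℕ; inject₁; fromℕ; fromℕ<; splitAt; _↑ˡ_; _↑ʳ_)
import Data.Fin.Properties as Fin
open import Data.Fin.Properties using (toℕ-injective) renaming (_≟_ to _≟F_)
open import Data.Fin.Relation.Unary.Top using (view; view-fromℕ; view-inject₁; ‵fromℕ; ‵inject₁)
open import Data.Integer using (ℤ; +_; 0ℤ; 1ℤ; -_; _+_; _-_; _*_)
open import Data.Integer.Divisibility.Signed using (_∣_; divides; ∣-refl; ∣m∣n⇒∣m-n; ∣n⇒∣m*n; ∣⇒∣ᵤ)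
open import Data.Integer.Properties hiding (_≟_)
open import Algebra.Properties.CommutativeSemigroup +-commutativeSemigroup
  using () renaming (interchange to +-interchange)
open import Data.Integer.Tactic.RingSolver using (solve-∀)
open import Data.List using (List; []; _∷_; _++_; map; concat; allFin; tabulate; foldr)
open import Data.List.Properties using (map-tabulate)
open import Data.Nat as ℕ using (ℕ; zero; suc; _≤_; _∸_; _≡ᵇ_; s≤s)
open import Data.Nat.DivMod using (_/_; m/n*n≡m; n/n≡1)
open import Data.Nat.Divisibility using () renaming (_∣_ to _∣ℕ_)
import Data.Nat.Properties as ℕ
open import Algebra.Properties.CommutativeSemigroup ℕ.+-commutativeSemigroup
  using () renaming (x∙yz≈y∙xz to ℕ-+-left-comm)
open import Data.Product using (Σ; _×_; _,_; proj₁; proj₂)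
open import Data.Sum using (_⊎_; inj₁; inj₂)
open import Data.Sum.Properties using (≡-dec; inj₁-injective; inj₂-injective)
open import Data.Unit using (⊤; tt)
open import Data.Unit.Properties using () renaming (_≟_ to _≟⊤_)
open import Function using (_∘_; _↔_; Inverse; mk↔ₛ′)
open import Relation.Binary.Bundles using (Setoid)
open import Relation.Binary.Definitions using (DecidableEquality)
open import Relation.Binary.PropositionalEquality
import Relation.Binary.Reasoning.Setoid as SetoidReasoning
open import Relation.Nullary using (yes; no; ¬_)
open import Relation.Nullary.Decidable using (⌊_⌋; isYes≗does; toSum)

open import Defs

-- Sums and Kronecker deltas

module _ {A : Set} where

  ΣL-cong : (xs : List A) {f g : A → ℤ} → (∀ x → f x ≡ g x) → ΣL xs f ≡ ΣL xs g
  ΣL-cong []       f≗g = refl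
  ΣL-cong (x ∷ xs) f≗g = cong₂ _+_ (f≗g x) (ΣL-cong xs f≗g)

  ΣL-zero : (xs : List A) {f : A → ℤ} → (∀ x → f x ≡ 0ℤ) → ΣL xs f ≡ 0ℤ
  ΣL-zero []       f≗0 = refl
  ΣL-zero (x ∷ xs) f≗0 = cong₂ _+_ (f≗0 x) (ΣL-zero xs f≗0)

  ΣL-+ : (xs : List A) (f g : A → ℤ) → ΣL xs (λ x → f x + g x) ≡ ΣL xs f + ΣL xs g
  ΣL-+ []       f g = refl
  ΣL-+ (x ∷ xs) f g =
    trans (cong (_+_ (f x + g x)) (ΣL-+ xs f g)) (+-interchange (f x) (g x) _ _)

  ΣL-*ˡ : (xs : List A) (c : ℤ) (f : A → ℤ) → ΣL xs (λ x → c * f x) ≡ c * ΣL xs f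
  ΣL-*ˡ []       c f = sym (*-zeroʳ c)
  ΣL-*ˡ (x ∷ xs) c f = trans (cong (_+_ (c * f x)) (ΣL-*ˡ xs c f)) (sym (*-distribˡ-+ c (f x) _))

  ΣL-*ʳ : (xs : List A) (c : ℤ) (f : A → ℤ) → ΣL xs (λ x → f x * c) ≡ ΣL xs f * c
  ΣL-*ʳ xs c f = trans (ΣL-cong xs (λ x → *-comm (f x) c)) (trans (ΣL-*ˡ xs c f) (*-comm c _))

  ΣL-neg : (xs : List A) (f : A → ℤ) → ΣL xs (λ x → - f x) ≡ - ΣL xs f
  ΣL-neg []       f = refl
  ΣL-neg (x ∷ xs) f = trans (cong (_+_ (- f x)) (ΣL-neg xs f)) (sym (neg-distrib-+ (f x) _))

  ΣL-- : (xs : List A) (f g : A → ℤ) → ΣL xs (λ x → f x - g x) ≡ ΣL xs f - ΣL xs g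
  ΣL-- xs f g = trans (ΣL-+ xs f (λ x → - g x)) (cong (_+_ (ΣL xs f)) (ΣL-neg xs g))

  ΣL-++ : (xs ys : List A) (f : A → ℤ) → ΣL (xs ++ ys) f ≡ ΣL xs f + ΣL ys f
  ΣL-++ []       ys f = sym (+-identityˡ _)
  ΣL-++ (x ∷ xs) ys f = trans (cong (_+_ (f x)) (ΣL-++ xs ys f)) (sym (+-assoc (f x) _ _))

  ΣL-concat : (xss : List (List A)) (f : A → ℤ) → ΣL (concat xss) f ≡ ΣL xss (λ xs → ΣL xs f)
  ΣL-concat []         f = refl
  ΣL-concat (xs ∷ xss) f = trans (ΣL-++ xs (concat xss) f) (cong (_+_ (ΣL xs f)) (ΣL-concat xss f))

ΣL-map : {A B : Set} (g : A → B) (xs : List A) (f : B → ℤ) → ΣL (map g xs) f ≡ ΣL xs (f ∘ g)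
ΣL-map g []       f = refl
ΣL-map g (x ∷ xs) f = cong (_+_ (f (g x))) (ΣL-map g xs f)

ΣL-swap : {A B : Set} (xs : List A) (ys : List B) (f : A → B → ℤ) →
          ΣL xs (λ a → ΣL ys (f a)) ≡ ΣL ys (λ b → ΣL xs (λ a → f a b))
ΣL-swap []       ys f = sym (ΣL-zero ys (λ _ → refl))
ΣL-swap (x ∷ xs) ys f =
  trans (cong (_+_ (ΣL ys (f x))) (ΣL-swap xs ys f)) (sym (ΣL-+ ys (f x) _))

ΣL-tabulate : {A : Set} (n : ℕ) (g : Fin n → A) (h : A → ℤ) → ΣL (tabulate g) h ≡ ΣL (allFin n) (h ∘ g)
ΣL-tabulate zero    g h = refl
ΣL-tabulate (suc n) g h =
  cong (_+_ (h (g zero))) (trans (ΣL-tabulate n (g ∘ suc) h) (sym (ΣL-tabulate n suc (h ∘ g))))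

module _ {A : Set} (_≟_ : DecidableEquality A) where

  idM-refl : ∀ a → idM _≟_ a a ≡ 1ℤ
  idM-refl a with a ≟ a
  ... | yes _  = refl
  ... | no a≢a = ⊥-elim (a≢a refl)

  idM-≢ : ∀ {a b} → ¬ a ≡ b → idM _≟_ a b ≡ 0ℤ
  idM-≢ {a} {b} a≢b with a ≟ b
  ... | yes a≡b = ⊥-elim (a≢b a≡b)
  ... | no _    = refl

  idM-sym : ∀ a b → idM _≟_ a b ≡ idM _≟_ b a
  idM-sym a b with a ≟ b | b ≟ a
  ... | yes _   | yes _   = refl
  ... | no _    | no _    = refl
  ... | yes a≡b | no b≢a  = ⊥-elim (b≢a (sym a≡b))
  ... | no a≢b  | yes b≡a = ⊥-elim (a≢b (sym b≡a))

idM-resp : {A B : Set} (_≟ᴬ_ : DecidableEquality A) (_≟ᴮ_ : DecidableEquality B)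
           {a a′ : A} {b b′ : B} → (a ≡ a′ → b ≡ b′) → (b ≡ b′ → a ≡ a′) →
           idM _≟ᴬ_ a a′ ≡ idM _≟ᴮ_ b b′
idM-resp _≟ᴬ_ _≟ᴮ_ {a} {a′} {b} {b′} to from with a ≟ᴬ a′ | b ≟ᴮ b′
... | yes _  | yes _  = refl
... | no _   | no _   = refl
... | yes p  | no ¬q  = ⊥-elim (¬q (to p))
... | no ¬p  | yes q  = ⊥-elim (¬p (from q))

idM-↔ : {A B : Set} (_≟ᴬ_ : DecidableEquality A) (_≟ᴮ_ : DecidableEquality B) (f : A ↔ B) →
        ∀ a a′ → idM _≟ᴮ_ (Inverse.to f a) (Inverse.to f a′) ≡ idM _≟ᴬ_ a a′
idM-↔ _≟ᴬ_ _≟ᴮ_ f a a′ = idM-resp _≟ᴮ_ _≟ᴬ_ injective (cong to)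
  where
    open Inverse f
    injective : to a ≡ to a′ → a ≡ a′
    injective eq = trans (sym (strictlyInverseʳ a)) (trans (cong from eq) (strictlyInverseʳ a′))

b2z-≡ᵇ : ∀ a b → b2z (a ≡ᵇ b) ≡ idM ℕ._≟_ a b
b2z-≡ᵇ zero    zero    = refl
b2z-≡ᵇ zero    (suc b) = refl
b2z-≡ᵇ (suc a) zero    = refl
b2z-≡ᵇ (suc a) (suc b) = trans (b2z-≡ᵇ a b) (idM-resp ℕ._≟_ ℕ._≟_ (cong suc) ℕ.suc-injective)

b2z-∧ : ∀ {n} (i i′ : Fin n) b → b2z (⌊ i ≟F i′ ⌋ ∧ b) ≡ idM _≟F_ i i′ * b2z b
b2z-∧ i i′ b with i ≟F i′
... | yes _ = sym (*-identityˡ (b2z b))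
... | no _  = refl

b2z-adjacent : ∀ a b → b2z ((suc a ≡ᵇ b) ∨ (suc b ≡ᵇ a)) ≡ b2z (a ≡ᵇ suc b) + b2z (suc a ≡ᵇ b)
b2z-adjacent zero    zero          = refl
b2z-adjacent zero    (suc zero)    = refl
b2z-adjacent zero    (suc (suc b)) = refl
b2z-adjacent (suc zero)    zero    = refl
b2z-adjacent (suc (suc a)) zero    = refl
b2z-adjacent (suc a) (suc b)       = b2z-adjacent a b

-- Matrices over enumerated types

-- A list of the elements of A without repetitions, expressed by the sifting property of the Kronecker delta.
record Enumeration (A : Set) : Set where
  field
    elems : List A
    _≟_   : DecidableEquality A
    sift  : ∀ a (f : A → ℤ) → ΣL elems (λ b → idM _≟_ a b * f b) ≡ f a

  δ : A → A → ℤ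
  δ = idM _≟_

  sift′ : ∀ a (f : A → ℤ) → ΣL elems (λ b → f b * δ b a) ≡ f a
  sift′ a f = trans (ΣL-cong elems (λ b → trans (*-comm (f b) _) (cong (_* f b) (idM-sym _≟_ b a))))
                    (sift a f)

Fin-enumeration : (n : ℕ) → Enumeration (Fin n)
Fin-enumeration n = record { elems = allFin n ; _≟_ = _≟F_ ; sift = sift-Fin n }
  where
    sift-Fin : ∀ n (a : Fin n) (f : Fin n → ℤ) → ΣL (allFin n) (λ b → idM _≟F_ a b * f b) ≡ f a
    sift-Fin (suc n) zero f = begin
      1ℤ * f zero + ΣL (tabulate suc) (λ b → idM _≟F_ zero b * f b)
        ≡⟨ cong₂ _+_ (*-identityˡ (f zero)) (ΣL-tabulate n suc (λ b → idM _≟F_ zero b * f b)) ⟩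
      f zero + ΣL (allFin n) (λ _ → 0ℤ)
        ≡⟨ cong (_+_ (f zero)) (ΣL-zero (allFin n) (λ _ → refl)) ⟩
      f zero + 0ℤ
        ≡⟨ +-identityʳ _ ⟩
      f zero ∎
      where open ≡-Reasoning
    sift-Fin (suc n) (suc a) f = begin
      0ℤ + ΣL (tabulate suc) (λ b → idM _≟F_ (suc a) b * f b)
        ≡⟨ +-identityˡ _ ⟩
      ΣL (tabulate suc) (λ b → idM _≟F_ (suc a) b * f b)
        ≡⟨ ΣL-tabulate n suc (λ b → idM _≟F_ (suc a) b * f b) ⟩
      ΣL (allFin n) (λ b → idM _≟F_ (suc a) (suc b) * f (suc b))
        ≡⟨ ΣL-cong (allFin n) (λ b → cong (_* f (suc b)) (suc-δ b)) ⟩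
      ΣL (allFin n) (λ b → idM _≟F_ a b * f (suc b))
        ≡⟨ sift-Fin n a (f ∘ suc) ⟩
      f (suc a) ∎
      where open ≡-Reasoning
            suc-δ : ∀ b → idM _≟F_ (suc a) (suc b) ≡ idM _≟F_ a b
            suc-δ b = idM-resp _≟F_ _≟F_ Fin.suc-injective (cong suc)

⊤-enumeration : Enumeration ⊤
⊤-enumeration = record
  { elems = tt ∷ []
  ; _≟_   = _≟⊤_
  ; sift  = λ { tt f → trans (+-identityʳ _) (*-identityˡ (f tt)) }
  }

_⊎-enumeration_ : {A B : Set} → Enumeration A → Enumeration B → Enumeration (A ⊎ B)
_⊎-enumeration_ {A} {B} EA EB = record
  { elems = map inj₁ EA.elems ++ map inj₂ EB.elems
  ; _≟_   = ≡-dec EA._≟_ EB._≟_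
  ; sift  = sift-⊎
  }
  where
    module EA = Enumeration EA
    module EB = Enumeration EB
    _≟_ = ≡-dec EA._≟_ EB._≟_
    split : ∀ (h : A ⊎ B → ℤ) →
            ΣL (map inj₁ EA.elems ++ map inj₂ EB.elems) h ≡ ΣL EA.elems (h ∘ inj₁) + ΣL EB.elems (h ∘ inj₂)
    split h = trans (ΣL-++ (map inj₁ EA.elems) _ h) (cong₂ _+_ (ΣL-map inj₁ EA.elems h) (ΣL-map inj₂ EB.elems h))
    sift-⊎ : ∀ c (f : A ⊎ B → ℤ) → ΣL (map inj₁ EA.elems ++ map inj₂ EB.elems) (λ c′ → idM _≟_ c c′ * f c′) ≡ f c
    sift-⊎ (inj₁ a) f = begin
      ΣL (map inj₁ EA.elems ++ map inj₂ EB.elems) (λ c′ → idM _≟_ (inj₁ a) c′ * f c′)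
        ≡⟨ split (λ c′ → idM _≟_ (inj₁ a) c′ * f c′) ⟩
      ΣL EA.elems (λ a′ → idM _≟_ (inj₁ a) (inj₁ a′) * f (inj₁ a′)) + ΣL EB.elems (λ _ → 0ℤ)
        ≡⟨ cong₂ _+_ (ΣL-cong EA.elems (λ a′ → cong (_* f (inj₁ a′)) (idM-resp _≟_ EA._≟_ inj₁-injective (cong inj₁))))
                     (ΣL-zero EB.elems (λ _ → refl)) ⟩
      ΣL EA.elems (λ a′ → EA.δ a a′ * f (inj₁ a′)) + 0ℤ
        ≡⟨ +-identityʳ _ ⟩
      ΣL EA.elems (λ a′ → EA.δ a a′ * f (inj₁ a′))
        ≡⟨ EA.sift a (f ∘ inj₁) ⟩
      f (inj₁ a) ∎
      where open ≡-Reasoning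
    sift-⊎ (inj₂ b) f = begin
      ΣL (map inj₁ EA.elems ++ map inj₂ EB.elems) (λ c′ → idM _≟_ (inj₂ b) c′ * f c′)
        ≡⟨ split (λ c′ → idM _≟_ (inj₂ b) c′ * f c′) ⟩
      ΣL EA.elems (λ _ → 0ℤ) + ΣL EB.elems (λ b′ → idM _≟_ (inj₂ b) (inj₂ b′) * f (inj₂ b′))
        ≡⟨ cong₂ _+_ (ΣL-zero EA.elems (λ _ → refl))
                     (ΣL-cong EB.elems (λ b′ → cong (_* f (inj₂ b′)) (idM-resp _≟_ EB._≟_ inj₂-injective (cong inj₂)))) ⟩
      0ℤ + ΣL EB.elems (λ b′ → EB.δ b b′ * f (inj₂ b′))
        ≡⟨ +-identityˡ _ ⟩
      ΣL EB.elems (λ b′ → EB.δ b b′ * f (inj₂ b′))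
        ≡⟨ EB.sift b (f ∘ inj₂) ⟩
      f (inj₂ b) ∎
      where open ≡-Reasoning

Equivalent : {A B : Set} → Enumeration A → Enumeration B → Mat A A → Mat B B → Set
Equivalent EA EB = EquivZ (Enumeration.elems EA) (Enumeration.elems EB) (Enumeration._≟_ EA) (Enumeration._≟_ EB)

≐-setoid : (A B : Set) → Setoid _ _
≐-setoid A B = record
  { Carrier       = Mat A B
  ; _≈_           = _≐_
  ; isEquivalence = record
    { refl  = λ _ _ → refl
    ; sym   = λ M≐N a b → sym (M≐N a b)
    ; trans = λ M≐N N≐O a b → trans (M≐N a b) (N≐O a b)
    }
  }

module ≐-Reasoning {A B : Set} = SetoidReasoning (≐-setoid A B)

mul-assoc : {A B C D : Set} (eB : List B) (eC : List C) (X : Mat A B) (Y : Mat B C) (Z : Mat C D) →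
            mul eC (mul eB X Y) Z ≐ mul eB X (mul eC Y Z)
mul-assoc eB eC X Y Z a d = begin
  ΣL eC (λ c → ΣL eB (λ b → X a b * Y b c) * Z c d)   ≡⟨ ΣL-cong eC (λ c → ΣL-*ʳ eB (Z c d) (λ b → X a b * Y b c)) ⟨
  ΣL eC (λ c → ΣL eB (λ b → X a b * Y b c * Z c d))   ≡⟨ ΣL-swap eB eC (λ b c → X a b * Y b c * Z c d) ⟨
  ΣL eB (λ b → ΣL eC (λ c → X a b * Y b c * Z c d))   ≡⟨ ΣL-cong eB (λ b → ΣL-cong eC (λ c → *-assoc (X a b) _ _)) ⟩
  ΣL eB (λ b → ΣL eC (λ c → X a b * (Y b c * Z c d))) ≡⟨ ΣL-cong eB (λ b → ΣL-*ˡ eC (X a b) (λ c → Y b c * Z c d)) ⟩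
  ΣL eB (λ b → X a b * ΣL eC (λ c → Y b c * Z c d))   ∎
  where open ≡-Reasoning

module _ {A B C : Set} (e : List B) where

  mul-congˡ : {X X′ : Mat A B} (Y : Mat B C) → X ≐ X′ → mul e X Y ≐ mul e X′ Y
  mul-congˡ Y X≐X′ a c = ΣL-cong e (λ b → cong (_* Y b c) (X≐X′ a b))

  mul-congʳ : (X : Mat A B) {Y Y′ : Mat B C} → Y ≐ Y′ → mul e X Y ≐ mul e X Y′
  mul-congʳ X Y≐Y′ a c = ΣL-cong e (λ b → cong (X a b *_) (Y≐Y′ b c))

module _ {A B : Set} (E : Enumeration A) where
  open Enumeration E

  mul-identityˡ : (M : Mat A B) → mul elems (idM _≟_) M ≐ M
  mul-identityˡ M a b = sift a (λ a′ → M a′ b)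

mul-inverse : {A B C : Set} (eA : List A) (EB : Enumeration B) (_≟ᶜ_ : DecidableEquality C)
              {X : Mat C B} {X′ : Mat B C} {Y : Mat B A} {Y′ : Mat A B} →
              mul (Enumeration.elems EB) X X′ ≐ idM _≟ᶜ_ → mul eA Y Y′ ≐ idM (Enumeration._≟_ EB) →
              mul eA (mul (Enumeration.elems EB) X Y) (mul (Enumeration.elems EB) Y′ X′) ≐ idM _≟ᶜ_
mul-inverse {B = B} eA EB _≟ᶜ_ {X} {X′} {Y} {Y′} XX′≐I YY′≐I = begin
  mul eA (mul eB X Y) (mul eB Y′ X′)   ≈⟨ mul-assoc eB eA X Y (mul eB Y′ X′) ⟩
  mul eB X (mul eA Y (mul eB Y′ X′))   ≈⟨ mul-congʳ eB X (mul-assoc eA eB Y Y′ X′) ⟨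
  mul eB X (mul eB (mul eA Y Y′) X′)   ≈⟨ mul-congʳ eB X (mul-congˡ eB X′ YY′≐I) ⟩
  mul eB X (mul eB (idM _≟ᴮ_) X′)      ≈⟨ mul-congʳ eB X (mul-identityˡ EB X′) ⟩
  mul eB X X′                          ≈⟨ XX′≐I ⟩
  idM _≟ᶜ_                             ∎
  where open ≐-Reasoning
        eB : List B
        eB = Enumeration.elems EB
        _≟ᴮ_ : DecidableEquality B
        _≟ᴮ_ = Enumeration._≟_ EB

EquivZ-trans : {A B C : Set} (EA : Enumeration A) (EB : Enumeration B) (EC : Enumeration C)
               {M : Mat A A} {N : Mat B B} {O : Mat C C} →
               Equivalent EA EB M N → Equivalent EB EC N O → Equivalent EA EC M O
EquivZ-trans {A} {B} {C} EA EB EC {M} {N} {O}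
  (P₁ , P₁′ , Q₁ , Q₁′ , P₁P₁′ , P₁′P₁ , Q₁Q₁′ , Q₁′Q₁ , P₁MQ₁)
  (P₂ , P₂′ , Q₂ , Q₂′ , P₂P₂′ , P₂′P₂ , Q₂Q₂′ , Q₂′Q₂ , P₂NQ₂) =
  mul eB P₂ P₁ , mul eB P₁′ P₂′ , mul eB Q₁ Q₂ , mul eB Q₂′ Q₁′ ,
  mul-inverse eA EB _ {P₂} {P₂′} {P₁} {P₁′} P₂P₂′ P₁P₁′ ,
  mul-inverse eC EB _ {P₁′} {P₁} {P₂′} {P₂} P₁′P₁ P₂′P₂ ,
  mul-inverse eC EB _ {Q₁} {Q₁′} {Q₂} {Q₂′} Q₁Q₁′ Q₂Q₂′ ,
  mul-inverse eA EB _ {Q₂′} {Q₂} {Q₁′} {Q₁} Q₂′Q₂ Q₁′Q₁ ,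
  (begin
    mul eA (mul eA (mul eB P₂ P₁) M) (mul eB Q₁ Q₂) ≈⟨ mul-congˡ eA (mul eB Q₁ Q₂) (mul-assoc eB eA P₂ P₁ M) ⟩
    mul eA (mul eB P₂ (mul eA P₁ M)) (mul eB Q₁ Q₂) ≈⟨ mul-assoc eB eA P₂ (mul eA P₁ M) (mul eB Q₁ Q₂) ⟩
    mul eB P₂ (mul eA (mul eA P₁ M) (mul eB Q₁ Q₂)) ≈⟨ mul-congʳ eB P₂ (mul-assoc eA eB (mul eA P₁ M) Q₁ Q₂) ⟨
    mul eB P₂ (mul eB (mul eA (mul eA P₁ M) Q₁) Q₂) ≈⟨ mul-congʳ eB P₂ (mul-congˡ eB Q₂ P₁MQ₁) ⟩
    mul eB P₂ (mul eB N Q₂)                         ≈⟨ mul-assoc eB eB P₂ N Q₂ ⟨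
    mul eB (mul eB P₂ N) Q₂                         ≈⟨ P₂NQ₂ ⟩
    O                                               ∎)
  where open ≐-Reasoning
        eA : List A
        eA = Enumeration.elems EA
        eB : List B
        eB = Enumeration.elems EB
        eC : List C
        eC = Enumeration.elems EC

module Relabel {A B : Set} (EA : Enumeration A) (EB : Enumeration B)
               (f g : A ↔ B) (s : B → ℤ) (s²≡1 : ∀ b → s b * s b ≡ 1ℤ) where
  private
    module EA = Enumeration EA
    module EB = Enumeration EB
    eA : List A
    eA = EA.elems
    eB : List B
    eB = EB.elems
  open Inverse
  open ≡-Reasoning

  P : Mat B A
  P b a = s b * EA.δ (from f b) a

  P⁻¹ : Mat A B
  P⁻¹ a b = EB.δ (to f a) b * s b

  Q : Mat A B
  Q a b = EA.δ a (from g b)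

  Q⁻¹ : Mat B A
  Q⁻¹ b a = EB.δ b (to g a)

  P·P⁻¹ : mul eA P P⁻¹ ≐ EB.δ
  P·P⁻¹ b b′ = begin
    ΣL eA (λ a → s b * EA.δ (from f b) a * (EB.δ (to f a) b′ * s b′))
      ≡⟨ ΣL-cong eA (λ a → *-assoc (s b) _ _) ⟩
    ΣL eA (λ a → s b * (EA.δ (from f b) a * (EB.δ (to f a) b′ * s b′)))
      ≡⟨ ΣL-*ˡ eA (s b) _ ⟩
    s b * ΣL eA (λ a → EA.δ (from f b) a * (EB.δ (to f a) b′ * s b′))
      ≡⟨ cong (s b *_) (EA.sift (from f b) (λ a → EB.δ (to f a) b′ * s b′)) ⟩
    s b * (EB.δ (to f (from f b)) b′ * s b′)
      ≡⟨ cong (λ c → s b * (EB.δ c b′ * s b′)) (strictlyInverseˡ f b) ⟩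
    s b * (EB.δ b b′ * s b′)
      ≡⟨ unit b b′ ⟩
    EB.δ b b′ ∎
    where
      unit : ∀ b b′ → s b * (EB.δ b b′ * s b′) ≡ EB.δ b b′
      unit b b′ with b EB.≟ b′
      ... | yes refl = trans (cong (s b *_) (*-identityˡ (s b))) (s²≡1 b)
      ... | no _     = *-zeroʳ (s b)

  P⁻¹·P : mul eB P⁻¹ P ≐ EA.δ
  P⁻¹·P a a′ = begin
    ΣL eB (λ b → EB.δ (to f a) b * s b * (s b * EA.δ (from f b) a′))
      ≡⟨ ΣL-cong eB (λ b → *-assoc (EB.δ (to f a) b) _ _) ⟩
    ΣL eB (λ b → EB.δ (to f a) b * (s b * (s b * EA.δ (from f b) a′)))
      ≡⟨ EB.sift (to f a) (λ b → s b * (s b * EA.δ (from f b) a′)) ⟩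
    s (to f a) * (s (to f a) * EA.δ (from f (to f a)) a′)
      ≡⟨ *-assoc (s (to f a)) _ _ ⟨
    s (to f a) * s (to f a) * EA.δ (from f (to f a)) a′
      ≡⟨ cong₂ _*_ (s²≡1 (to f a)) (cong (λ c → EA.δ c a′) (strictlyInverseʳ f a)) ⟩
    1ℤ * EA.δ a a′
      ≡⟨ *-identityˡ _ ⟩
    EA.δ a a′ ∎

  Q·Q⁻¹ : mul eB Q Q⁻¹ ≐ EA.δ
  Q·Q⁻¹ a a′ = trans (EB.sift′ (to g a′) (λ b → EA.δ a (from g b))) (cong (EA.δ a) (strictlyInverseʳ g a′))

  Q⁻¹·Q : mul eA Q⁻¹ Q ≐ EB.δ
  Q⁻¹·Q b b′ = trans (EA.sift′ (from g b′) (λ a → EB.δ b (to g a))) (cong (EB.δ b) (strictlyInverseˡ g b′))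

  P·M·Q : ∀ {M : Mat A A} {N : Mat B B} → (∀ a a′ → M a a′ ≡ s (to f a) * N (to f a) (to g a′)) →
          mul eA (mul eA P M) Q ≐ N
  P·M·Q {M} {N} M≡sN b b′ = begin
    ΣL eA (λ a → mul eA P M b a * EA.δ a (from g b′))
      ≡⟨ EA.sift′ (from g b′) (mul eA P M b) ⟩
    ΣL eA (λ a → s b * EA.δ (from f b) a * M a (from g b′))
      ≡⟨ ΣL-cong eA (λ a → *-assoc (s b) _ _) ⟩
    ΣL eA (λ a → s b * (EA.δ (from f b) a * M a (from g b′)))
      ≡⟨ ΣL-*ˡ eA (s b) _ ⟩
    s b * ΣL eA (λ a → EA.δ (from f b) a * M a (from g b′))
      ≡⟨ cong (s b *_) (EA.sift (from f b) (λ a → M a (from g b′))) ⟩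
    s b * M (from f b) (from g b′)
      ≡⟨ cong (s b *_) (M≡sN (from f b) (from g b′)) ⟩
    s b * (s (to f (from f b)) * N (to f (from f b)) (to g (from g b′)))
      ≡⟨ cong₂ (λ c c′ → s b * (s c * N c c′)) (strictlyInverseˡ f b) (strictlyInverseˡ g b′) ⟩
    s b * (s b * N b b′)
      ≡⟨ *-assoc (s b) _ _ ⟨
    s b * s b * N b b′
      ≡⟨ cong (_* N b b′) (s²≡1 b) ⟩
    1ℤ * N b b′
      ≡⟨ *-identityˡ _ ⟩
    N b b′ ∎

  relabel : ∀ {M : Mat A A} {N : Mat B B} → (∀ a a′ → M a a′ ≡ s (to f a) * N (to f a) (to g a′)) →
            Equivalent EA EB M N
  relabel M≡sN = P , P⁻¹ , Q , Q⁻¹ , P·P⁻¹ , P⁻¹·P , Q·Q⁻¹ , Q⁻¹·Q , P·M·Q M≡sN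

open Relabel using (relabel)

module _ {A : Set} (E : Enumeration A) where
  open Enumeration E

  I+N-inverse : (N N′ : Mat A A) → (∀ x y z → N x y * N′ y z ≡ 0ℤ) → (∀ x z → N x z + N′ x z ≡ 0ℤ) →
                mul elems (λ x y → δ x y + N x y) (λ y z → δ y z + N′ y z) ≐ δ
  I+N-inverse N N′ NN′≡0 N+N′≡0 x z = begin
    ΣL elems (λ y → (δ x y + N x y) * (δ y z + N′ y z))
      ≡⟨ ΣL-cong elems (λ y → *-distribʳ-+ (δ y z + N′ y z) (δ x y) (N x y)) ⟩
    ΣL elems (λ y → δ x y * (δ y z + N′ y z) + N x y * (δ y z + N′ y z))
      ≡⟨ ΣL-+ elems (λ y → δ x y * (δ y z + N′ y z)) (λ y → N x y * (δ y z + N′ y z)) ⟩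
    ΣL elems (λ y → δ x y * (δ y z + N′ y z)) + ΣL elems (λ y → N x y * (δ y z + N′ y z))
      ≡⟨ cong₂ _+_ (sift x (λ y → δ y z + N′ y z)) (ΣL-cong elems (λ y → *-distribˡ-+ (N x y) _ _)) ⟩
    (δ x z + N′ x z) + ΣL elems (λ y → N x y * δ y z + N x y * N′ y z)
      ≡⟨ cong (_+_ (δ x z + N′ x z)) (ΣL-+ elems (λ y → N x y * δ y z) (λ y → N x y * N′ y z)) ⟩
    (δ x z + N′ x z) + (ΣL elems (λ y → N x y * δ y z) + ΣL elems (λ y → N x y * N′ y z))
      ≡⟨ cong (λ t → (δ x z + N′ x z) + (t + ΣL elems (λ y → N x y * N′ y z))) (sift′ z (N x)) ⟩
    (δ x z + N′ x z) + (N x z + ΣL elems (λ y → N x y * N′ y z))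
      ≡⟨ cong (λ t → (δ x z + N′ x z) + (N x z + t)) (ΣL-zero elems (λ y → NN′≡0 x y z)) ⟩
    (δ x z + N′ x z) + (N x z + 0ℤ)
      ≡⟨ regroup (δ x z) (N x z) (N′ x z) ⟩
    δ x z + (N x z + N′ x z)
      ≡⟨ cong (_+_ (δ x z)) (N+N′≡0 x z) ⟩
    δ x z + 0ℤ
      ≡⟨ +-identityʳ _ ⟩
    δ x z ∎
    where
      open ≡-Reasoning
      regroup : ∀ a b c → (a + c) + (b + 0ℤ) ≡ a + (b + c)
      regroup = solve-∀

  square-zero-inverse : (C : Mat A A) → (∀ x y z → (C x y - δ x y) * (C y z - δ y z) ≡ 0ℤ) →
                        (mul elems C (λ x y → δ x y + (δ x y - C x y)) ≐ δ) ×
                        (mul elems (λ x y → δ x y + (δ x y - C x y)) C ≐ δ)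
  square-zero-inverse C sq≡0 =
    (λ x z → trans (mul-congˡ elems C⁻¹ C≐I+N x z) (I+N-inverse N N′ NN′≡0 N+N′≡0 x z)) ,
    (λ x z → trans (mul-congʳ elems C⁻¹ C≐I+N x z) (I+N-inverse N′ N N′N≡0 N′+N≡0 x z))
    where
      C⁻¹ N N′ : Mat A A
      C⁻¹ x y = δ x y + (δ x y - C x y)
      N  x y = C x y - δ x y
      N′ x y = δ x y - C x y
      C≐I+N : C ≐ (λ x y → δ x y + N x y)
      C≐I+N x y = lem (C x y) (δ x y)
        where lem : ∀ c d → c ≡ d + (c - d)
              lem = solve-∀
      NN′≡0 : ∀ x y z → N x y * N′ y z ≡ 0ℤ
      NN′≡0 x y z = trans (lem (C x y) (δ x y) (C y z) (δ y z)) (cong -_ (sq≡0 x y z))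
        where lem : ∀ a b c d → (a - b) * (d - c) ≡ - ((a - b) * (c - d))
              lem = solve-∀
      N′N≡0 : ∀ x y z → N′ x y * N y z ≡ 0ℤ
      N′N≡0 x y z = trans (lem (C x y) (δ x y) (C y z) (δ y z)) (cong -_ (sq≡0 x y z))
        where lem : ∀ a b c d → (b - a) * (c - d) ≡ - ((a - b) * (c - d))
              lem = solve-∀
      N+N′≡0 : ∀ x z → N x z + N′ x z ≡ 0ℤ
      N+N′≡0 x z = lem (C x z) (δ x z)
        where lem : ∀ c d → (c - d) + (d - c) ≡ 0ℤ
              lem = solve-∀
      N′+N≡0 : ∀ x z → N′ x z + N x z ≡ 0ℤ
      N′+N≡0 x z = trans (+-comm (N′ x z) (N x z)) (N+N′≡0 x z)

-- Counting and divisibility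

sumᶠ : (ℓ : ℕ) → (Fin ℓ → ℕ) → ℕ
sumᶠ zero    m = 0
sumᶠ (suc ℓ) m = m zero ℕ.+ sumᶠ ℓ (m ∘ suc)

Σ↔sumᶠ : (ℓ : ℕ) (m : Fin ℓ → ℕ) → Σ (Fin ℓ) (Fin ∘ m) ↔ Fin (sumᶠ ℓ m)
Σ↔sumᶠ ℓ m = mk↔ₛ′ (join ℓ m) (split ℓ m) (join-split ℓ m) (split-join ℓ m)
  where
    join : ∀ ℓ m → Σ (Fin ℓ) (Fin ∘ m) → Fin (sumᶠ ℓ m)
    join (suc ℓ) m (zero  , j) = j ↑ˡ sumᶠ ℓ (m ∘ suc)
    join (suc ℓ) m (suc i , j) = m zero ↑ʳ join ℓ (m ∘ suc) (i , j)
    split : ∀ ℓ m → Fin (sumᶠ ℓ m) → Σ (Fin ℓ) (Fin ∘ m)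
    split (suc ℓ) m k with splitAt (m zero) k
    ... | inj₁ j = zero , j
    ... | inj₂ k′ = suc (proj₁ (split ℓ (m ∘ suc) k′)) , proj₂ (split ℓ (m ∘ suc) k′)
    split-join : ∀ ℓ m x → split ℓ m (join ℓ m x) ≡ x
    split-join (suc ℓ) m (zero , j) rewrite Fin.splitAt-↑ˡ (m zero) j (sumᶠ ℓ (m ∘ suc)) = refl
    split-join (suc ℓ) m (suc i , j)
      rewrite Fin.splitAt-↑ʳ (m zero) (sumᶠ ℓ (m ∘ suc)) (join ℓ (m ∘ suc) (i , j))
            | split-join ℓ (m ∘ suc) (i , j) = refl
    join-split : ∀ ℓ m k → join ℓ m (split ℓ m k) ≡ k
    join-split (suc ℓ) m k with splitAt (m zero) k in eq
    ... | inj₁ j  = Fin.splitAt⁻¹-↑ˡ eq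
    ... | inj₂ k′ = trans (cong (m zero ↑ʳ_) (join-split ℓ (m ∘ suc) k′)) (Fin.splitAt⁻¹-↑ʳ eq)

inner-vertex-count : ∀ ℓ (m : Fin ℓ → ℕ) → sumᶠ ℓ m ≡ nVtx ℓ m ∸ ℓ ∸ 1
inner-vertex-count ℓ m = sym (begin
  suc (foldr ℕ._+_ 0 (map (suc ∘ m) (allFin ℓ))) ∸ ℓ ∸ 1
    ≡⟨ cong (λ xs → suc (foldr ℕ._+_ 0 xs) ∸ ℓ ∸ 1) (map-tabulate (λ i → i) (suc ∘ m)) ⟩
  suc (foldr ℕ._+_ 0 (tabulate (suc ∘ m))) ∸ ℓ ∸ 1
    ≡⟨ cong (λ n → suc n ∸ ℓ ∸ 1) (vertices-on-tentacles ℓ m) ⟩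
  suc (ℓ ℕ.+ sumᶠ ℓ m) ∸ ℓ ∸ 1
    ≡⟨ cancel ℓ (sumᶠ ℓ m) ⟩
  sumᶠ ℓ m ∎)
  where
    open ≡-Reasoning
    vertices-on-tentacles : ∀ ℓ (m : Fin ℓ → ℕ) → foldr ℕ._+_ 0 (tabulate (suc ∘ m)) ≡ ℓ ℕ.+ sumᶠ ℓ m
    vertices-on-tentacles zero    m = refl
    vertices-on-tentacles (suc ℓ) m =
      cong suc (trans (cong (m zero ℕ.+_) (vertices-on-tentacles ℓ (m ∘ suc))) (ℕ-+-left-comm (m zero) ℓ _))
    cancel : ∀ a b → suc (a ℕ.+ b) ∸ a ∸ 1 ≡ b
    cancel zero    b = refl
    cancel (suc a) b = cancel a b

∣-backwards : ∀ {a : ℤ} (g c : ℕ → ℤ) (n : ℕ) →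
              (∀ k → k ℕ.< n → c k * g (suc k) - g k - g (suc (suc k)) ≡ 0ℤ) →
              a ∣ g n → a ∣ g (suc n) → ∀ k → k ℕ.≤ n → a ∣ g k
∣-backwards {a} g c n recurrence a∣gₙ a∣gₙ₊₁ k k≤n = proj₁ (downwards (n ℕ.∸ k) k (ℕ.m∸n+n≡m k≤n))
  where
    solve-for-g₀ : ∀ x g₀ g₂ → x - g₀ - g₂ ≡ 0ℤ → g₀ ≡ x - g₂
    solve-for-g₀ x g₀ g₂ eq = trans (sym (+-identityʳ g₀)) (trans (cong (_+_ g₀) (sym eq)) (lem x g₀ g₂))
      where lem : ∀ x g₀ g₂ → g₀ + (x - g₀ - g₂) ≡ x - g₂
            lem = solve-∀
    downwards : ∀ t k → t ℕ.+ k ≡ n → a ∣ g k × a ∣ g (suc k)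
    downwards zero    k refl = a∣gₙ , a∣gₙ₊₁
    downwards (suc t) k t+k≡n = a∣gₖ , a∣gₖ₊₁
      where
        k<n : k ℕ.< n
        k<n = subst (k ℕ.<_) t+k≡n (s≤s (ℕ.m≤n+m k t))
        a∣gₖ₊₁ : a ∣ g (suc k)
        a∣gₖ₊₁ = proj₁ (downwards t (suc k) (trans (ℕ.+-suc t k) t+k≡n))
        a∣gₖ₊₂ : a ∣ g (suc (suc k))
        a∣gₖ₊₂ = proj₂ (downwards t (suc k) (trans (ℕ.+-suc t k) t+k≡n))
        a∣gₖ : a ∣ g k
        a∣gₖ = subst (a ∣_) (sym (solve-for-g₀ (c k * g (suc k)) (g k) (g (suc (suc k))) (recurrence k k<n)))
                     (∣m∣n⇒∣m-n (∣n⇒∣m*n (c k) a∣gₖ₊₁) a∣gₖ₊₂)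

-- The starlike tree

module _ {ℓ : ℕ} {m : Fin ℓ → ℕ} where

  private
    V : Set
    V = Vtx ℓ m
    δᵛ : V → V → ℤ
    δᵛ = idM _≟V_

  ΣL-allVtx : (h : V → ℤ) →
              ΣL (allVtx ℓ m) h ≡ h center + ΣL (allFin ℓ) (λ i → ΣL (allFin (suc (m i))) (h ∘ tent i))
  ΣL-allVtx h = cong (_+_ (h center)) (begin
    ΣL (concat (map tentacle (allFin ℓ))) h
      ≡⟨ ΣL-concat (map tentacle (allFin ℓ)) h ⟩
    ΣL (map tentacle (allFin ℓ)) (λ xs → ΣL xs h)
      ≡⟨ ΣL-map tentacle (allFin ℓ) (λ xs → ΣL xs h) ⟩
    ΣL (allFin ℓ) (λ i → ΣL (tentacle i) h)
      ≡⟨ ΣL-cong (allFin ℓ) (λ i → ΣL-map (tent i) (allFin (suc (m i))) h) ⟩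
    ΣL (allFin ℓ) (λ i → ΣL (allFin (suc (m i))) (h ∘ tent i)) ∎)
    where open ≡-Reasoning
          tentacle : Fin ℓ → List V
          tentacle i = map (tent i) (allFin (suc (m i)))

  tent-δ : ∀ {i} (j j′ : Fin (suc (m i))) → δᵛ (tent i j) (tent i j′) ≡ idM _≟F_ j j′
  tent-δ j j′ = idM-resp _≟V_ _≟F_ (λ { refl → refl }) (cong (tent _))

  tent-δ-≢ : ∀ {i i′} (j : Fin (suc (m i))) (j′ : Fin (suc (m i′))) → ¬ i ≡ i′ →
             δᵛ (tent i j) (tent i′ j′) ≡ 0ℤ
  tent-δ-≢ j j′ i≢i′ = idM-≢ _≟V_ (λ e → i≢i′ (proj₁ (tent-inj e)))

  sift-tentacle : ∀ i j i′ (f : V → ℤ) →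
                  ΣL (allFin (suc (m i′))) (λ j′ → δᵛ (tent i j) (tent i′ j′) * f (tent i′ j′)) ≡
                  idM _≟F_ i i′ * f (tent i j)
  sift-tentacle i j i′ f with toSum (i ≟F i′)
  ... | inj₁ refl = begin
    ΣL (allFin (suc (m i))) (λ j′ → δᵛ (tent i j) (tent i j′) * f (tent i j′))
      ≡⟨ ΣL-cong (allFin (suc (m i))) (λ j′ → cong (_* f (tent i j′)) (tent-δ j j′)) ⟩
    ΣL (allFin (suc (m i))) (λ j′ → idM _≟F_ j j′ * f (tent i j′))
      ≡⟨ Enumeration.sift (Fin-enumeration (suc (m i))) j (f ∘ tent i) ⟩
    f (tent i j)
      ≡⟨ *-identityˡ _ ⟨
    1ℤ * f (tent i j)
      ≡⟨ cong (_* f (tent i j)) (idM-refl _≟F_ i) ⟨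
    idM _≟F_ i i * f (tent i j) ∎
    where open ≡-Reasoning
  ... | inj₂ i≢i′ = trans (ΣL-zero (allFin (suc (m i′))) (λ j′ → cong (_* f (tent i′ j′)) (tent-δ-≢ j j′ i≢i′)))
                          (sym (cong (_* f (tent i j)) (idM-≢ _≟F_ i≢i′)))

  vertices : Enumeration V
  vertices = record { elems = allVtx ℓ m ; _≟_ = _≟V_ ; sift = sift-V }
    where
      open ≡-Reasoning
      sift-V : ∀ x (f : V → ℤ) → ΣL (allVtx ℓ m) (λ y → δᵛ x y * f y) ≡ f x
      sift-V center f = begin
        ΣL (allVtx ℓ m) (λ y → δᵛ center y * f y)
          ≡⟨ ΣL-allVtx (λ y → δᵛ center y * f y) ⟩
        1ℤ * f center + ΣL (allFin ℓ) (λ i → ΣL (allFin (suc (m i))) (λ _ → 0ℤ))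
          ≡⟨ cong₂ _+_ (*-identityˡ (f center)) (ΣL-zero (allFin ℓ) (λ i → ΣL-zero (allFin (suc (m i))) (λ _ → refl))) ⟩
        f center + 0ℤ
          ≡⟨ +-identityʳ _ ⟩
        f center ∎
      sift-V (tent i j) f = begin
        ΣL (allVtx ℓ m) (λ y → δᵛ (tent i j) y * f y)
          ≡⟨ ΣL-allVtx (λ y → δᵛ (tent i j) y * f y) ⟩
        0ℤ + ΣL (allFin ℓ) (λ i′ → ΣL (allFin (suc (m i′))) (λ j′ → δᵛ (tent i j) (tent i′ j′) * f (tent i′ j′)))
          ≡⟨ +-identityˡ _ ⟩
        ΣL (allFin ℓ) (λ i′ → ΣL (allFin (suc (m i′))) (λ j′ → δᵛ (tent i j) (tent i′ j′) * f (tent i′ j′)))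
          ≡⟨ ΣL-cong (allFin ℓ) (λ i′ → sift-tentacle i j i′ f) ⟩
        ΣL (allFin ℓ) (λ i′ → idM _≟F_ i i′ * f (tent i j))
          ≡⟨ Enumeration.sift (Fin-enumeration ℓ) i (λ _ → f (tent i j)) ⟩
        f (tent i j) ∎

  private
    module Vᴱ = Enumeration vertices

  -- The indicator of the vertex at distance p from v₀ along tentacle i:
  -- v₀ itself for p = 0, v_{i,p} for 1 ≤ p ≤ n_i, and no vertex for p > n_i.
  atDistance : Fin ℓ → ℕ → V → ℤ
  atDistance i p center      = b2z (p ≡ᵇ 0)
  atDistance i p (tent i′ j) = idM _≟F_ i i′ * b2z (p ≡ᵇ suc (toℕ j))

  atDistance-zero : ∀ i u → atDistance i 0 u ≡ δᵛ center u
  atDistance-zero i center      = refl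
  atDistance-zero i (tent i′ j) = *-zeroʳ (idM _≟F_ i i′)

  atDistance-tent : ∀ i j u → atDistance i (suc (toℕ j)) u ≡ δᵛ (tent i j) u
  atDistance-tent i j center = refl
  atDistance-tent i j (tent i′ j′) with toSum (i ≟F i′)
  ... | inj₁ refl = begin
    idM _≟F_ i i * b2z (toℕ j ≡ᵇ toℕ j′) ≡⟨ cong₂ _*_ (idM-refl _≟F_ i) (b2z-≡ᵇ (toℕ j) (toℕ j′)) ⟩
    1ℤ * idM ℕ._≟_ (toℕ j) (toℕ j′)      ≡⟨ *-identityˡ _ ⟩
    idM ℕ._≟_ (toℕ j) (toℕ j′)           ≡⟨ idM-resp ℕ._≟_ _≟F_ toℕ-injective (cong toℕ) ⟩
    idM _≟F_ j j′                        ≡⟨ tent-δ j j′ ⟨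
    δᵛ (tent i j) (tent i j′)            ∎
    where open ≡-Reasoning
  ... | inj₂ i≢i′ = trans (cong (_* b2z (toℕ j ≡ᵇ toℕ j′)) (idM-≢ _≟F_ i≢i′)) (sym (tent-δ-≢ j j′ i≢i′))

  atDistance-beyond : ∀ i p u → m i ℕ.< p → atDistance i (suc p) u ≡ 0ℤ
  atDistance-beyond i p center      _    = refl
  atDistance-beyond i p (tent i′ j) mi<p with toSum (i ≟F i′)
  ... | inj₁ refl = trans (cong (idM _≟F_ i i *_) (trans (b2z-≡ᵇ p (toℕ j)) (idM-≢ ℕ._≟_ p≢j))) (*-zeroʳ (idM _≟F_ i i))
    where p≢j : ¬ p ≡ toℕ j
          p≢j refl = ℕ.<⇒≱ mi<p (ℕ.≤-pred (Fin.toℕ<n j))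
  ... | inj₂ i≢i′ = cong (_* b2z (p ≡ᵇ toℕ j)) (idM-≢ _≟F_ i≢i′)

  -- v along tentacle i, indexed by the distance from v₀; it is 0 beyond the leaf.
  along : Fin ℓ → (V → ℤ) → ℕ → ℤ
  along i v p = ΣL (allVtx ℓ m) (λ u → atDistance i p u * v u)

  along-center : ∀ i v → along i v 0 ≡ v center
  along-center i v = trans (ΣL-cong (allVtx ℓ m) (λ u → cong (_* v u) (atDistance-zero i u))) (Vᴱ.sift center v)

  along-tent : ∀ i j v → along i v (suc (toℕ j)) ≡ v (tent i j)
  along-tent i j v = trans (ΣL-cong (allVtx ℓ m) (λ u → cong (_* v u) (atDistance-tent i j u))) (Vᴱ.sift (tent i j) v)

  along-beyond : ∀ i p v → m i ℕ.< p → along i v (suc p) ≡ 0ℤ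
  along-beyond i p v mi<p = ΣL-zero (allVtx ℓ m) (λ u → cong (_* v u) (atDistance-beyond i p u mi<p))

  along-positional : ∀ i v (w : ℕ → ℤ) → v center ≡ w 0 → (∀ j → v (tent i j) ≡ w (suc (toℕ j))) →
                     ∀ p → p ℕ.≤ suc (m i) → along i v p ≡ w p
  along-positional i v w v₀≡w₀ vⱼ≡wⱼ zero    _          = trans (along-center i v) v₀≡w₀
  along-positional i v w v₀≡w₀ vⱼ≡wⱼ (suc p) (s≤s p≤mᵢ) = begin
    along i v (suc p)       ≡⟨ cong (along i v ∘ suc) (Fin.toℕ-fromℕ< (s≤s p≤mᵢ)) ⟨
    along i v (suc (toℕ j)) ≡⟨ along-tent i j v ⟩
    v (tent i j)            ≡⟨ vⱼ≡wⱼ j ⟩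
    w (suc (toℕ j))         ≡⟨ cong (w ∘ suc) (Fin.toℕ-fromℕ< (s≤s p≤mᵢ)) ⟩
    w (suc p)               ∎
    where open ≡-Reasoning
          j = fromℕ< (s≤s p≤mᵢ)

  adjacency-tent : ∀ i j u → b2z (adjB (tent i j) u) ≡ atDistance i (toℕ j) u + atDistance i (suc (suc (toℕ j))) u
  adjacency-tent i j center       = trans (cong b2z (isYes≗does (toℕ j ℕ.≟ 0))) (sym (+-identityʳ _))
  adjacency-tent i j (tent i′ j′) = begin
    b2z (⌊ i ≟F i′ ⌋ ∧ (⌊ suc a ℕ.≟ b ⌋ ∨ ⌊ suc b ℕ.≟ a ⌋))
      ≡⟨ b2z-∧ i i′ _ ⟩
    idM _≟F_ i i′ * b2z (⌊ suc a ℕ.≟ b ⌋ ∨ ⌊ suc b ℕ.≟ a ⌋)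
      ≡⟨ cong (λ x → idM _≟F_ i i′ * b2z x) (cong₂ _∨_ (isYes≗does (suc a ℕ.≟ b)) (isYes≗does (suc b ℕ.≟ a))) ⟩
    idM _≟F_ i i′ * b2z ((suc a ≡ᵇ b) ∨ (suc b ≡ᵇ a))
      ≡⟨ cong (idM _≟F_ i i′ *_) (b2z-adjacent a b) ⟩
    idM _≟F_ i i′ * (b2z (a ≡ᵇ suc b) + b2z (suc a ≡ᵇ b))
      ≡⟨ *-distribˡ-+ (idM _≟F_ i i′) _ _ ⟩
    idM _≟F_ i i′ * b2z (a ≡ᵇ suc b) + idM _≟F_ i i′ * b2z (suc a ≡ᵇ b) ∎
    where open ≡-Reasoning
          a b : ℕ
          a = toℕ j
          b = toℕ j′

  onTentacle : Fin ℓ → (V → ℤ) → V → ℤ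
  onTentacle i v center      = 0ℤ
  onTentacle i v (tent i′ j) = idM _≟F_ i i′ * v (tent i′ j)

  Label : Set
  Label = (Fin ℓ ⊎ ⊤) ⊎ Fin (sumᶠ ℓ m)

  labels : Enumeration Label
  labels = (Fin-enumeration ℓ ⊎-enumeration ⊤-enumeration) ⊎-enumeration Fin-enumeration (sumᶠ ℓ m)

  private
    module Σ↔ = Inverse (Σ↔sumᶠ ℓ m)

    innerVertex laterVertex : Σ (Fin ℓ) (Fin ∘ m) → V
    innerVertex (i , j) = tent i (inject₁ j)
    laterVertex (i , j) = tent i (suc j)

  -- v₀ and the leaves index the rows of L*, v₀ and its neighbours its columns;
  -- the remaining vertices index the identity block.
  rowLabel : V → Label
  rowLabel center = inj₁ (inj₂ tt)
  rowLabel (tent i j) with view j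
  ... | ‵fromℕ      = inj₁ (inj₁ i)
  ... | ‵inject₁ j′ = inj₂ (Σ↔.to (i , j′))

  rowVertex : Label → V
  rowVertex (inj₁ (inj₁ i)) = lastV i
  rowVertex (inj₁ (inj₂ tt)) = center
  rowVertex (inj₂ κ)        = innerVertex (Σ↔.from κ)

  rowLabels : V ↔ Label
  rowLabels = mk↔ₛ′ rowLabel rowVertex label-vertex vertex-label
    where
      label-inner : ∀ x → rowLabel (innerVertex x) ≡ inj₂ (Σ↔.to x)
      label-inner (i , j) rewrite view-inject₁ j = refl
      label-vertex : ∀ κ → rowLabel (rowVertex κ) ≡ κ
      label-vertex (inj₁ (inj₁ i)) rewrite view-fromℕ (m i) = refl
      label-vertex (inj₁ (inj₂ tt)) = refl
      label-vertex (inj₂ κ) = trans (label-inner (Σ↔.from κ)) (cong inj₂ (Σ↔.strictlyInverseˡ κ))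
      vertex-label : ∀ x → rowVertex (rowLabel x) ≡ x
      vertex-label center = refl
      vertex-label (tent i j) with view j
      ... | ‵fromℕ      = refl
      ... | ‵inject₁ j′ = cong innerVertex (Σ↔.strictlyInverseʳ (i , j′))

  colLabel : V → Label
  colLabel center           = inj₁ (inj₂ tt)
  colLabel (tent i zero)    = inj₁ (inj₁ i)
  colLabel (tent i (suc j)) = inj₂ (Σ↔.to (i , j))

  colVertex : Label → V
  colVertex (inj₁ (inj₁ i)) = firstV i
  colVertex (inj₁ (inj₂ tt)) = center
  colVertex (inj₂ κ)        = laterVertex (Σ↔.from κ)

  colLabels : V ↔ Label
  colLabels = mk↔ₛ′ colLabel colVertex label-vertex vertex-label
    where
      label-vertex : ∀ κ → colLabel (colVertex κ) ≡ κ
      label-vertex (inj₁ (inj₁ i)) = refl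
      label-vertex (inj₁ (inj₂ tt)) = refl
      label-vertex (inj₂ κ) = cong inj₂ (Σ↔.strictlyInverseˡ κ)
      vertex-label : ∀ x → colVertex (colLabel x) ≡ x
      vertex-label center           = refl
      vertex-label (tent i zero)    = refl
      vertex-label (tent i (suc j)) = cong laterVertex (Σ↔.strictlyInverseʳ (i , j))

  module _ (d : V → ℕ) where

    private
      L : Mat V V
      L = LapM ℓ m d

    L-tent : ∀ i j u → L (tent i j) u ≡
             + d (tent i j) * atDistance i (suc (toℕ j)) u - atDistance i (toℕ j) u - atDistance i (suc (suc (toℕ j))) u
    L-tent i j u = begin
      δᵛ (tent i j) u * + d (tent i j) - b2z (adjB (tent i j) u)
        ≡⟨ cong₂ (λ x y → x * + d (tent i j) - y) (sym (atDistance-tent i j u)) (adjacency-tent i j u) ⟩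
      atDistance i (suc (toℕ j)) u * + d (tent i j) - (atDistance i (toℕ j) u + atDistance i (suc (suc (toℕ j))) u)
        ≡⟨ regroup (atDistance i (suc (toℕ j)) u) (+ d (tent i j)) (atDistance i (toℕ j) u)
                   (atDistance i (suc (suc (toℕ j))) u) ⟩
      + d (tent i j) * atDistance i (suc (toℕ j)) u - atDistance i (toℕ j) u - atDistance i (suc (suc (toℕ j))) u ∎
      where open ≡-Reasoning
            regroup : ∀ a₁ dⱼ a₀ a₂ → a₁ * dⱼ - (a₀ + a₂) ≡ dⱼ * a₁ - a₀ - a₂
            regroup = solve-∀

    L-tent-action : ∀ i j (v : V → ℤ) → ΣL (allVtx ℓ m) (λ u → L (tent i j) u * v u) ≡
                    + d (tent i j) * v (tent i j) - along i v (toℕ j) - along i v (suc (suc (toℕ j)))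
    L-tent-action i j v = begin
      ΣL vs (λ u → L (tent i j) u * v u)
        ≡⟨ ΣL-cong vs (λ u → trans (cong (_* v u) (L-tent i j u)) (distrib (+ d (tent i j)) _ _ _ (v u))) ⟩
      ΣL vs (λ u → dⱼ * (a₁ u * v u) - a₀ u * v u - a₂ u * v u)
        ≡⟨ ΣL-- vs (λ u → dⱼ * (a₁ u * v u) - a₀ u * v u) (λ u → a₂ u * v u) ⟩
      ΣL vs (λ u → dⱼ * (a₁ u * v u) - a₀ u * v u) - along i v (suc (suc (toℕ j)))
        ≡⟨ cong (_- along i v (suc (suc (toℕ j)))) (ΣL-- vs (λ u → dⱼ * (a₁ u * v u)) (λ u → a₀ u * v u)) ⟩
      ΣL vs (λ u → dⱼ * (a₁ u * v u)) - along i v (toℕ j) - along i v (suc (suc (toℕ j)))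
        ≡⟨ cong (λ x → x - along i v (toℕ j) - along i v (suc (suc (toℕ j)))) (ΣL-*ˡ vs dⱼ (λ u → a₁ u * v u)) ⟩
      dⱼ * along i v (suc (toℕ j)) - along i v (toℕ j) - along i v (suc (suc (toℕ j)))
        ≡⟨ cong (λ x → dⱼ * x - along i v (toℕ j) - along i v (suc (suc (toℕ j)))) (along-tent i j v) ⟩
      dⱼ * v (tent i j) - along i v (toℕ j) - along i v (suc (suc (toℕ j))) ∎
      where open ≡-Reasoning
            vs : List V
            vs = allVtx ℓ m
            dⱼ : ℤ
            dⱼ = + d (tent i j)
            a₀ a₁ a₂ : V → ℤ
            a₀ = atDistance i (toℕ j)
            a₁ = atDistance i (suc (toℕ j))
            a₂ = atDistance i (suc (suc (toℕ j)))
            distrib : ∀ x y z w t → (x * y - z - w) * t ≡ x * (y * t) - z * t - w * t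
            distrib = solve-∀

    L-center-center : L center center ≡ + d center
    L-center-center = trans (+-identityʳ _) (*-identityˡ _)

    L-tent-center : ∀ i j → L (tent i j) center ≡ - b2z ⌊ toℕ j ℕ.≟ 0 ⌋
    L-tent-center i j = +-identityˡ _

    L-tent-≢ : ∀ {i i′} (j : Fin (suc (m i))) (j′ : Fin (suc (m i′))) → ¬ i ≡ i′ → L (tent i j) (tent i′ j′) ≡ 0ℤ
    L-tent-≢ {i} {i′} j j′ i≢i′ = begin
      L (tent i j) (tent i′ j′)
        ≡⟨ L-tent i j (tent i′ j′) ⟩
      + d (tent i j) * (δ * _) - δ * _ - δ * _
        ≡⟨ cong (λ x → + d (tent i j) * (x * _) - x * _ - x * _) (idM-≢ _≟F_ i≢i′) ⟩
      + d (tent i j) * 0ℤ - 0ℤ - 0ℤ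
        ≡⟨ cong (λ x → x - 0ℤ - 0ℤ) (*-zeroʳ (+ d (tent i j))) ⟩
      0ℤ ∎
      where open ≡-Reasoning
            δ = idM _≟F_ i i′

    L-sym : ∀ u v → L u v ≡ L v u
    L-sym u v = cong₂ _-_ diagonal (cong b2z (adjB-sym u v))
      where
        diagonal : δᵛ u v * + d u ≡ δᵛ v u * + d v
        diagonal with toSum (u ≟V v)
        ... | inj₁ refl = refl
        ... | inj₂ u≢v  = trans (cong (_* + d u) (idM-≢ _≟V_ u≢v))
                                (sym (cong (_* + d v) (idM-≢ _≟V_ (λ v≡u → u≢v (sym v≡u)))))
        ⌊≟⌋-sym : ∀ {n} (i i′ : Fin n) → ⌊ i ≟F i′ ⌋ ≡ ⌊ i′ ≟F i ⌋
        ⌊≟⌋-sym i i′ with i ≟F i′ | i′ ≟F i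
        ... | yes _   | yes _   = refl
        ... | no _    | no _    = refl
        ... | yes i≡i′ | no i′≢i = ⊥-elim (i′≢i (sym i≡i′))
        ... | no i≢i′  | yes i′≡i = ⊥-elim (i≢i′ (sym i′≡i))
        adjB-sym : ∀ u v → adjB u v ≡ adjB v u
        adjB-sym center     center       = refl
        adjB-sym center     (tent _ _)   = refl
        adjB-sym (tent _ _) center       = refl
        adjB-sym (tent i j) (tent i′ j′) =
          cong₂ _∧_ (⌊≟⌋-sym i i′) (∨-comm ⌊ suc (toℕ j) ℕ.≟ toℕ j′ ⌋ ⌊ suc (toℕ j′) ℕ.≟ toℕ j ⌋)

    degreeAt : Fin ℓ → ℕ → ℤ
    degreeAt i = along i (λ u → + d u)

    -- The row of Q at the vertex at distance p along tentacle i; the recursion is what makes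
    -- L·Q send the row of each non-leaf tentacle vertex to minus the unit row of its successor (L·Q-inner).
    Qrow : Fin ℓ → ℕ → V → ℤ
    Qrow i zero          = δᵛ center
    Qrow i (suc zero)    = δᵛ (tent i zero)
    Qrow i (suc (suc p)) z = atDistance i (suc (suc p)) z + degreeAt i (suc p) * Qrow i (suc p) z - Qrow i p z

    Q : Mat V V
    Q center     = δᵛ center
    Q (tent i j) = Qrow i (suc (toℕ j))

    Q⁻¹ : Mat V V
    Q⁻¹ center           = δᵛ center
    Q⁻¹ (tent i zero)    = δᵛ (tent i zero)
    Q⁻¹ (tent i (suc j)) = λ z → - L (tent i (inject₁ j)) z

    L·Q-inner : ∀ i j z → toℕ j ℕ.< m i →
                ΣL (allVtx ℓ m) (λ y → L (tent i j) y * Q y z) ≡ - atDistance i (suc (suc (toℕ j))) z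
    L·Q-inner i j z j<mᵢ = begin
      ΣL (allVtx ℓ m) (λ y → L (tent i j) y * Q y z)
        ≡⟨ L-tent-action i j Qz ⟩
      dⱼ * q₁ - along i Qz k - along i Qz (suc (suc k))
        ≡⟨ cong₂ (λ x y → dⱼ * q₁ - x - y) (along-Q k (ℕ.m≤n⇒m≤1+n (ℕ.<⇒≤ j<mᵢ))) (along-Q (suc (suc k)) (s≤s j<mᵢ)) ⟩
      dⱼ * q₁ - q₀ - (a₂ + degreeAt i (suc k) * q₁ - q₀)
        ≡⟨ cong (λ x → dⱼ * q₁ - q₀ - (a₂ + x * q₁ - q₀)) (along-tent i j (λ u → + d u)) ⟩
      dⱼ * q₁ - q₀ - (a₂ + dⱼ * q₁ - q₀)
        ≡⟨ cancel (dⱼ * q₁) q₀ a₂ ⟩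
      - a₂ ∎
      where
        open ≡-Reasoning
        k : ℕ
        k = toℕ j
        dⱼ q₀ q₁ a₂ : ℤ
        dⱼ = + d (tent i j)
        q₀ = Qrow i k z
        q₁ = Qrow i (suc k) z
        a₂ = atDistance i (suc (suc k)) z
        Qz : V → ℤ
        Qz y = Q y z
        along-Q : ∀ p → p ℕ.≤ suc (m i) → along i Qz p ≡ Qrow i p z
        along-Q = along-positional i Qz (λ p → Qrow i p z) refl (λ _ → refl)
        cancel : ∀ x y a → x - y - (a + x - y) ≡ - a
        cancel = solve-∀

    near-center·Q : ∀ (v : V → ℤ) → (∀ i k → v (tent i (suc k)) ≡ 0ℤ) →
                    ∀ z → ΣL (allVtx ℓ m) (λ y → v y * Q y z) ≡ v z
    near-center·Q v vanishes z = trans (ΣL-cong (allVtx ℓ m) pointwise) (Vᴱ.sift′ z v)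
      where
        pointwise : ∀ y → v y * Q y z ≡ v y * δᵛ y z
        pointwise center           = refl
        pointwise (tent i zero)    = refl
        pointwise (tent i (suc k)) = trans (cong (_* Q (tent i (suc k)) z) (vanishes i k))
                                           (sym (cong (_* δᵛ (tent i (suc k)) z) (vanishes i k)))

    Qrow-sum : ∀ i p (w : V → ℤ) →
               ΣL (allVtx ℓ m) (λ y → Qrow i (suc (suc p)) y * w y) ≡
               along i w (suc (suc p)) + degreeAt i (suc p) * ΣL (allVtx ℓ m) (λ y → Qrow i (suc p) y * w y)
                                       - ΣL (allVtx ℓ m) (λ y → Qrow i p y * w y)
    Qrow-sum i p w = begin
      ΣL vs (λ y → (a₂ y + D * q₁ y - q₀ y) * w y)
        ≡⟨ ΣL-cong vs (λ y → distrib (a₂ y) D (q₁ y) (q₀ y) (w y)) ⟩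
      ΣL vs (λ y → a₂ y * w y + D * (q₁ y * w y) - q₀ y * w y)
        ≡⟨ ΣL-- vs (λ y → a₂ y * w y + D * (q₁ y * w y)) (λ y → q₀ y * w y) ⟩
      ΣL vs (λ y → a₂ y * w y + D * (q₁ y * w y)) - Σq₀
        ≡⟨ cong (_- Σq₀) (ΣL-+ vs (λ y → a₂ y * w y) (λ y → D * (q₁ y * w y))) ⟩
      along i w (suc (suc p)) + ΣL vs (λ y → D * (q₁ y * w y)) - Σq₀
        ≡⟨ cong (λ x → along i w (suc (suc p)) + x - Σq₀) (ΣL-*ˡ vs D (λ y → q₁ y * w y)) ⟩
      along i w (suc (suc p)) + D * ΣL vs (λ y → q₁ y * w y) - Σq₀ ∎
      where
        open ≡-Reasoning
        vs : List V
        vs = allVtx ℓ m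
        a₂ q₁ q₀ : V → ℤ
        a₂ = atDistance i (suc (suc p))
        q₁ = Qrow i (suc p)
        q₀ = Qrow i p
        D : ℤ
        D = degreeAt i (suc p)
        Σq₀ : ℤ
        Σq₀ = ΣL vs (λ y → q₀ y * w y)
        distrib : ∀ a x q q′ t → (a + x * q - q′) * t ≡ a * t + x * (q * t) - q′ * t
        distrib = solve-∀

    along-Q⁻¹ : ∀ i p z → p ℕ.< m i → along i (λ y → Q⁻¹ y z) (suc (suc p)) ≡
                atDistance i (suc (suc p)) z - degreeAt i (suc p) * atDistance i (suc p) z + atDistance i p z
    along-Q⁻¹ i p z p<mᵢ = begin
      along i (λ y → Q⁻¹ y z) (suc (suc p))
        ≡⟨ cong (along i (λ y → Q⁻¹ y z) ∘ suc) (sym (cong suc toℕ-j)) ⟩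
      along i (λ y → Q⁻¹ y z) (suc (toℕ (suc j)))
        ≡⟨ along-tent i (suc j) (λ y → Q⁻¹ y z) ⟩
      - L (tent i k) z
        ≡⟨ cong -_ (L-tent i k z) ⟩
      - (+ d (tent i k) * atDistance i (suc (toℕ k)) z - atDistance i (toℕ k) z - atDistance i (suc (suc (toℕ k))) z)
        ≡⟨ cong₂ (λ x q → - (x * atDistance i (suc q) z - atDistance i q z - atDistance i (suc (suc q)) z)) dₖ≡D toℕ-k ⟩
      - (D * atDistance i (suc p) z - atDistance i p z - atDistance i (suc (suc p)) z)
        ≡⟨ rearrange D (atDistance i (suc p) z) (atDistance i p z) (atDistance i (suc (suc p)) z) ⟩
      atDistance i (suc (suc p)) z - D * atDistance i (suc p) z + atDistance i p z ∎
      where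
        open ≡-Reasoning
        D : ℤ
        D = degreeAt i (suc p)
        j : Fin (m i)
        j = fromℕ< p<mᵢ
        k : Fin (suc (m i))
        k = inject₁ j
        toℕ-j : toℕ j ≡ p
        toℕ-j = Fin.toℕ-fromℕ< p<mᵢ
        toℕ-k : toℕ k ≡ p
        toℕ-k = trans (Fin.toℕ-inject₁ j) toℕ-j
        dₖ≡D : + d (tent i k) ≡ D
        dₖ≡D = trans (sym (along-tent i k (λ u → + d u))) (cong (degreeAt i ∘ suc) toℕ-k)
        rearrange : ∀ x a₁ a₀ a₂ → - (x * a₁ - a₀ - a₂) ≡ a₂ - x * a₁ + a₀
        rearrange = solve-∀

    Q·Q⁻¹ : mul (allVtx ℓ m) Q Q⁻¹ ≐ δᵛ
    Q·Q⁻¹ center     z = Vᴱ.sift center (λ y → Q⁻¹ y z)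
    Q·Q⁻¹ (tent i j) z = trans (rows (suc (toℕ j)) (Fin.toℕ<n j)) (atDistance-tent i j z)
      where
        open ≡-Reasoning
        rows : ∀ p → p ℕ.≤ suc (m i) → ΣL (allVtx ℓ m) (λ y → Qrow i p y * Q⁻¹ y z) ≡ atDistance i p z
        rows zero          _            = trans (Vᴱ.sift center (λ y → Q⁻¹ y z)) (sym (atDistance-zero i z))
        rows (suc zero)    _            =
          trans (Vᴱ.sift (tent i zero) (λ y → Q⁻¹ y z)) (sym (atDistance-tent i zero z))
        rows (suc (suc p)) (s≤s p<mᵢ) = begin
          ΣL (allVtx ℓ m) (λ y → Qrow i (suc (suc p)) y * Q⁻¹ y z)
            ≡⟨ Qrow-sum i p (λ y → Q⁻¹ y z) ⟩
          along i (λ y → Q⁻¹ y z) (suc (suc p)) + D * ΣL (allVtx ℓ m) (λ y → Qrow i (suc p) y * Q⁻¹ y z)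
                                                 - ΣL (allVtx ℓ m) (λ y → Qrow i p y * Q⁻¹ y z)
            ≡⟨ cong₂ (λ x y → x + y) (cong₂ (λ x y → x + D * y) (along-Q⁻¹ i p z p<mᵢ) (rows (suc p) (ℕ.<⇒≤ (s≤s p<mᵢ))))
                     (cong -_ (rows p (ℕ.m≤n⇒m≤1+n (ℕ.<⇒≤ p<mᵢ)))) ⟩
          (a₂ - D * a₁ + a₀) + D * a₁ - a₀
            ≡⟨ cancel a₂ (D * a₁) a₀ ⟩
          a₂ ∎
          where
            D a₀ a₁ a₂ : ℤ
            D  = degreeAt i (suc p)
            a₀ = atDistance i p z
            a₁ = atDistance i (suc p) z
            a₂ = atDistance i (suc (suc p)) z
            cancel : ∀ a x b → (a - x + b) + x - b ≡ a
            cancel = solve-∀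

    Q⁻¹·Q : mul (allVtx ℓ m) Q⁻¹ Q ≐ δᵛ
    Q⁻¹·Q center           z = Vᴱ.sift center (λ y → Q y z)
    Q⁻¹·Q (tent i zero)    z = Vᴱ.sift (tent i zero) (λ y → Q y z)
    Q⁻¹·Q (tent i (suc j)) z = begin
      ΣL vs (λ y → - L (tent i (inject₁ j)) y * Q y z)
        ≡⟨ ΣL-cong vs (λ y → sym (neg-distribˡ-* (L (tent i (inject₁ j)) y) (Q y z))) ⟩
      ΣL vs (λ y → - (L (tent i (inject₁ j)) y * Q y z))
        ≡⟨ ΣL-neg vs (λ y → L (tent i (inject₁ j)) y * Q y z) ⟩
      - ΣL vs (λ y → L (tent i (inject₁ j)) y * Q y z)
        ≡⟨ cong -_ (L·Q-inner i (inject₁ j) z (Fin.inject₁ℕ< j)) ⟩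
      - - atDistance i (suc (suc (toℕ (inject₁ j)))) z
        ≡⟨ neg-involutive _ ⟩
      atDistance i (suc (suc (toℕ (inject₁ j)))) z
        ≡⟨ cong (λ q → atDistance i (suc (suc q)) z) (Fin.toℕ-inject₁ j) ⟩
      atDistance i (suc (toℕ (suc j))) z
        ≡⟨ atDistance-tent i (suc j) z ⟩
      δᵛ (tent i (suc j)) z ∎
      where open ≡-Reasoning
            vs : List V
            vs = allVtx ℓ m

    L-center-action : ∀ (v : V → ℤ) → ΣL (allVtx ℓ m) (λ u → L center u * v u) ≡
                      + d center * v center - ΣL (allFin ℓ) (λ i → v (tent i zero))
    L-center-action v = begin
      ΣL (allVtx ℓ m) (λ u → L center u * v u)
        ≡⟨ ΣL-allVtx (λ u → L center u * v u) ⟩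
      L center center * v center + ΣL (allFin ℓ) (λ i → ΣL (allFin (suc (m i))) (term i))
        ≡⟨ cong₂ _+_ (cong (_* v center) L-center-center) (ΣL-cong (allFin ℓ) first) ⟩
      + d center * v center + ΣL (allFin ℓ) (λ i → - v (tent i zero))
        ≡⟨ cong (_+_ (+ d center * v center)) (ΣL-neg (allFin ℓ) (λ i → v (tent i zero))) ⟩
      + d center * v center - ΣL (allFin ℓ) (λ i → v (tent i zero)) ∎
      where
        open ≡-Reasoning
        term : ∀ i → Fin (suc (m i)) → ℤ
        term i j = L center (tent i j) * v (tent i j)
        first : ∀ i → ΣL (allFin (suc (m i))) (term i) ≡ - v (tent i zero)
        first i = trans (cong₂ _+_ (-1*i≡-i (v (tent i zero)))
                                   (trans (ΣL-tabulate (m i) suc (term i)) (ΣL-zero (allFin (m i)) (λ _ → refl))))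
                        (+-identityʳ _)

    -- A tentacle vertex sees only its own tentacle and v₀.
    L-onTentacle : ∀ i i′ j (v : V → ℤ) →
                   ΣL (allVtx ℓ m) (λ u → L (tent i′ j) u * onTentacle i v u) ≡
                   idM _≟F_ i i′ * (ΣL (allVtx ℓ m) (λ u → L (tent i′ j) u * v u) - L (tent i′ j) center * v center)
    L-onTentacle i i′ j v = begin
      ΣL vs (λ u → L x u * onTentacle i v u)
        ≡⟨ ΣL-cong vs pointwise ⟩
      ΣL vs (λ u → idM _≟F_ i i′ * (L x u * v u - δᵛ center u * (L x center * v center)))
        ≡⟨ ΣL-*ˡ vs (idM _≟F_ i i′) _ ⟩
      idM _≟F_ i i′ * ΣL vs (λ u → L x u * v u - δᵛ center u * (L x center * v center))
        ≡⟨ cong (idM _≟F_ i i′ *_) (ΣL-- vs (λ u → L x u * v u) (λ u → δᵛ center u * (L x center * v center))) ⟩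
      idM _≟F_ i i′ * (ΣL vs (λ u → L x u * v u) - ΣL vs (λ u → δᵛ center u * (L x center * v center)))
        ≡⟨ cong (λ y → idM _≟F_ i i′ * (ΣL vs (λ u → L x u * v u) - y)) (Vᴱ.sift center (λ _ → L x center * v center)) ⟩
      idM _≟F_ i i′ * (ΣL vs (λ u → L x u * v u) - L x center * v center) ∎
      where
        open ≡-Reasoning
        vs : List V
        vs = allVtx ℓ m
        x : V
        x = tent i′ j
        pointwise : ∀ u → L x u * onTentacle i v u ≡ idM _≟F_ i i′ * (L x u * v u - δᵛ center u * (L x center * v center))
        pointwise center = lem (L x center * v center) (idM _≟F_ i i′) (L x center)
          where lem : ∀ a c l → l * 0ℤ ≡ c * (a - 1ℤ * a)
                lem = solve-∀
        pointwise (tent i″ k) with toSum (i′ ≟F i″)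
        ... | inj₁ refl = lem (L x (tent i′ k)) (idM _≟F_ i i′) (v (tent i′ k))
          where lem : ∀ l c w → l * (c * w) ≡ c * (l * w - 0ℤ)
                lem = solve-∀
        ... | inj₂ i′≢i″ = trans (cong (_* onTentacle i v (tent i″ k)) (L-tent-≢ j k i′≢i″))
                                 (sym (trans (cong (λ l → idM _≟F_ i i′ * (l * v (tent i″ k) - 0ℤ)) (L-tent-≢ j k i′≢i″))
                                             (*-zeroʳ (idM _≟F_ i i′))))

    module _ (r : V → ℕ) (A : IsArithStructure ℓ m d r) where
      open IsArithStructure A

      private
        r̂ : V → ℤ
        r̂ u = + r u
        rLeaf : Fin ℓ → ℤ
        rLeaf i = + r (lastV i)
        instance
          leaf-nonZero : ∀ {i} → ℕ.NonZero (r (lastV i))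
          leaf-nonZero {i} = ℕ.>-nonZero (r-pos (lastV i))

      kernel-along : ∀ i k → k ℕ.< suc (m i) →
                     degreeAt i (suc k) * along i r̂ (suc k) - along i r̂ k - along i r̂ (suc (suc k)) ≡ 0ℤ
      kernel-along i k k<n = subst equation (Fin.toℕ-fromℕ< k<n) (at-vertex (fromℕ< k<n))
        where
          open ≡-Reasoning
          equation : ℕ → Set
          equation q = degreeAt i (suc q) * along i r̂ (suc q) - along i r̂ q - along i r̂ (suc (suc q)) ≡ 0ℤ
          at-vertex : ∀ j → equation (toℕ j)
          at-vertex j = begin
            degreeAt i (suc (toℕ j)) * along i r̂ (suc (toℕ j)) - along i r̂ (toℕ j) - along i r̂ (suc (suc (toℕ j)))
              ≡⟨ cong₂ (λ x y → x * y - along i r̂ (toℕ j) - along i r̂ (suc (suc (toℕ j))))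
                       (along-tent i j (λ u → + d u)) (along-tent i j r̂) ⟩
            + d (tent i j) * r̂ (tent i j) - along i r̂ (toℕ j) - along i r̂ (suc (suc (toℕ j)))
              ≡⟨ L-tent-action i j r̂ ⟨
            ΣL (allVtx ℓ m) (λ u → L (tent i j) u * r̂ u)
              ≡⟨ kernel (tent i j) ⟩
            0ℤ ∎

      leaf-divides : ∀ i p → p ℕ.≤ suc (m i) → rLeaf i ∣ along i r̂ p
      leaf-divides i = ∣-backwards (along i r̂) (degreeAt i ∘ suc) (suc (m i)) (kernel-along i) rLeaf∣rLeaf rLeaf∣0
        where
          rLeaf∣rLeaf : rLeaf i ∣ along i r̂ (suc (m i))
          rLeaf∣rLeaf = subst (λ q → rLeaf i ∣ along i r̂ (suc q)) (Fin.toℕ-fromℕ (m i))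
                              (subst (rLeaf i ∣_) (sym (along-tent i (fromℕ (m i)) r̂)) ∣-refl)
          rLeaf∣0 : rLeaf i ∣ along i r̂ (suc (suc (m i)))
          rLeaf∣0 = subst (rLeaf i ∣_) (sym (along-beyond i (suc (m i)) r̂ (ℕ.n<1+n (m i)))) (divides 0ℤ refl)

      leaf-divides-tent : ∀ i j → r (lastV i) ∣ℕ r (tent i j)
      leaf-divides-tent i j =
        ∣⇒∣ᵤ (subst (rLeaf i ∣_) (along-tent i j r̂) (leaf-divides i (suc (toℕ j)) (Fin.toℕ<n j)))

      leaf-divides-center : ∀ i → r (lastV i) ∣ℕ r center
      leaf-divides-center i = ∣⇒∣ᵤ (subst (rLeaf i ∣_) (along-center i r̂) (leaf-divides i 0 ℕ.z≤n))

      -- Truncating division, exact on tentacle i and at v₀ by leaf-divides-tent and leaf-divides-center.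
      ratio : Fin ℓ → V → ℕ
      ratio i y = r y / r (lastV i)

      ratio-exact : ∀ i y → r (lastV i) ∣ℕ r y → rLeaf i * + ratio i y ≡ + r y
      ratio-exact i y rLeaf∣y = begin
        + r (lastV i) * + (r y / r (lastV i)) ≡⟨ pos-* (r (lastV i)) _ ⟨
        + (r (lastV i) ℕ.* (r y / r (lastV i))) ≡⟨ cong +_ (ℕ.*-comm (r (lastV i)) _) ⟩
        + (r y / r (lastV i) ℕ.* r (lastV i)) ≡⟨ cong +_ (m/n*n≡m rLeaf∣y) ⟩
        + r y ∎
        where open ≡-Reasoning

      scaledKernel : Fin ℓ → V → ℤ
      scaledKernel i = onTentacle i (λ y → + ratio i y)

      rLeaf·scaledKernel : ∀ i u → rLeaf i * scaledKernel i u ≡ onTentacle i r̂ u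
      rLeaf·scaledKernel i center      = *-zeroʳ (rLeaf i)
      rLeaf·scaledKernel i (tent i′ j) with toSum (i ≟F i′)
      ... | inj₁ refl = trans (swap (rLeaf i) (idM _≟F_ i i) (+ ratio i (tent i j)))
                              (cong (idM _≟F_ i i *_) (ratio-exact i (tent i j) (leaf-divides-tent i j)))
        where swap : ∀ x c q → x * (c * q) ≡ c * (x * q)
              swap = solve-∀
      ... | inj₂ i≢i′ = trans (cong (λ c → rLeaf i * (c * + ratio i (tent i′ j))) (idM-≢ _≟F_ i≢i′))
                              (trans (*-zeroʳ (rLeaf i)) (sym (cong (_* r̂ (tent i′ j)) (idM-≢ _≟F_ i≢i′))))

      private
        vs : List V
        vs = allVtx ℓ m
        T : Mat Label Label
        T = ⊕I (decStar ℓ) (Lstar ℓ m d r r-pos) (sumᶠ ℓ m)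

      rLeaf·leaf-combination : ∀ i i′ j → rLeaf i * ΣL vs (λ u → L (tent i′ j) u * scaledKernel i u) ≡
                                         idM _≟F_ i i′ * (b2z ⌊ toℕ j ℕ.≟ 0 ⌋ * + r center)
      rLeaf·leaf-combination i i′ j = begin
        rLeaf i * ΣL vs (λ u → L x u * scaledKernel i u)
          ≡⟨ ΣL-*ˡ vs (rLeaf i) (λ u → L x u * scaledKernel i u) ⟨
        ΣL vs (λ u → rLeaf i * (L x u * scaledKernel i u))
          ≡⟨ ΣL-cong vs (λ u → trans (swap (rLeaf i) (L x u) (scaledKernel i u))
                                     (cong (L x u *_) (rLeaf·scaledKernel i u))) ⟩
        ΣL vs (λ u → L x u * onTentacle i r̂ u)
          ≡⟨ L-onTentacle i i′ j r̂ ⟩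
        idM _≟F_ i i′ * (ΣL vs (λ u → L x u * r̂ u) - L x center * r̂ center)
          ≡⟨ cong₂ (λ s l → idM _≟F_ i i′ * (s - l * r̂ center)) (kernel x) (L-tent-center i′ j) ⟩
        idM _≟F_ i i′ * (0ℤ - - b2z ⌊ toℕ j ℕ.≟ 0 ⌋ * r̂ center)
          ≡⟨ cong (idM _≟F_ i i′ *_) (neg-neg (b2z ⌊ toℕ j ℕ.≟ 0 ⌋) (r̂ center)) ⟩
        idM _≟F_ i i′ * (b2z ⌊ toℕ j ℕ.≟ 0 ⌋ * + r center) ∎
        where
          open ≡-Reasoning
          x : V
          x = tent i′ j
          swap : ∀ a b c → a * (b * c) ≡ b * (a * c)
          swap = solve-∀
          neg-neg : ∀ b c → 0ℤ - - b * c ≡ b * c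
          neg-neg = solve-∀

      rLeaf·d* : ∀ i i′ → idM _≟F_ i i′ * (1ℤ * + r center) ≡ rLeaf i * T (inj₁ (inj₁ i)) (inj₁ (inj₁ i′))
      rLeaf·d* i i′ with i ≟F i′
      ... | yes refl = trans (*-identityˡ _) (trans (*-identityˡ _) (sym (ratio-exact i center (leaf-divides-center i))))
      ... | no _     = sym (*-zeroʳ (rLeaf i))

      leaf-combination : ∀ i y → ΣL vs (λ u → scaledKernel i u * L u y) ≡ T (inj₁ (inj₁ i)) (colLabel y)
      leaf-combination i y = trans (ΣL-cong vs symmetry) (row y)
        where
          open ≡-Reasoning
          symmetry : ∀ u → scaledKernel i u * L u y ≡ L y u * scaledKernel i u
          symmetry u = trans (*-comm (scaledKernel i u) (L u y)) (cong (_* scaledKernel i u) (L-sym u y))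
          row : ∀ y → ΣL vs (λ u → L y u * scaledKernel i u) ≡ T (inj₁ (inj₁ i)) (colLabel y)
          row center = begin
            ΣL vs (λ u → L center u * scaledKernel i u)
              ≡⟨ L-center-action (scaledKernel i) ⟩
            + d center * 0ℤ - ΣL (allFin ℓ) (λ i′ → idM _≟F_ i i′ * + ratio i (tent i′ zero))
              ≡⟨ cong₂ _-_ (*-zeroʳ (+ d center))
                           (Enumeration.sift (Fin-enumeration ℓ) i (λ i′ → + ratio i (tent i′ zero))) ⟩
            0ℤ - + ratio i (firstV i)
              ≡⟨ +-identityˡ _ ⟩
            - + ratio i (firstV i) ∎
          row (tent i′ zero)    = *-cancelˡ-≡ (rLeaf i) _ _ (trans (rLeaf·leaf-combination i i′ zero) (rLeaf·d* i i′))
          row (tent i′ (suc k)) = *-cancelˡ-≡ (rLeaf i) _ _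
            (trans (rLeaf·leaf-combination i i′ (suc k)) (trans (*-zeroʳ (idM _≟F_ i i′)) (sym (*-zeroʳ (rLeaf i)))))

      C : Mat V V
      C center = δᵛ center
      C (tent i j) with view j
      ... | ‵fromℕ      = scaledKernel i
      ... | ‵inject₁ j′ = δᵛ (tent i (inject₁ j′))

      C-square-zero : ∀ x y z → (C x y - δᵛ x y) * (C y z - δᵛ y z) ≡ 0ℤ
      C-square-zero x center z =
        trans (cong ((C x center - δᵛ x center) *_) (+-inverseʳ (δᵛ center z))) (*-zeroʳ (C x center - δᵛ x center))
      C-square-zero x (tent i j) z with view j
      ... | ‵fromℕ      = cong (_* (scaledKernel i z - δᵛ (lastV i) z)) (leaf-column x)
        where
          leaf-column : ∀ x → C x (lastV i) - δᵛ x (lastV i) ≡ 0ℤ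
          leaf-column center = +-inverseʳ (δᵛ center (lastV i))
          leaf-column (tent i′ j′) with view j′
          ... | ‵inject₁ j″ = +-inverseʳ (δᵛ (tent i′ (inject₁ j″)) (lastV i))
          ... | ‵fromℕ with toSum (i′ ≟F i)
          ...   | inj₁ refl = trans (cong₂ (λ c e → c * + ratio i (lastV i) - e)
                                           (idM-refl _≟F_ i) (idM-refl _≟V_ (lastV i)))
                                    (cong (λ q → 1ℤ * + q - 1ℤ) (n/n≡1 (r (lastV i))))
          ...   | inj₂ i′≢i = cong₂ (λ c e → c * + ratio i′ (lastV i) - e) (idM-≢ _≟F_ i′≢i) (tent-δ-≢ _ _ i′≢i)
      ... | ‵inject₁ j′ = trans (cong ((C x (tent i (inject₁ j′)) - δᵛ x (tent i (inject₁ j′))) *_)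
                                      (+-inverseʳ (δᵛ (tent i (inject₁ j′)) z)))
                                (*-zeroʳ (C x (tent i (inject₁ j′)) - δᵛ x (tent i (inject₁ j′))))

      sign : Label → ℤ
      sign (inj₁ _) = 1ℤ
      sign (inj₂ _) = - 1ℤ

      center-row-of-L* : ∀ z → L center z ≡ 1ℤ * T (inj₁ (inj₂ tt)) (colLabel z)
      center-row-of-L* center           = trans L-center-center (sym (*-identityˡ _))
      center-row-of-L* (tent i zero)    = refl
      center-row-of-L* (tent i (suc k)) = refl

      inner-row-of-I : ∀ i (j : Fin (m i)) z →
                  atDistance i (suc (suc (toℕ (inject₁ j)))) z ≡ T (inj₂ (Σ↔.to (i , j))) (colLabel z)
      inner-row-of-I i j z = begin
        atDistance i (suc (suc (toℕ (inject₁ j)))) z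
          ≡⟨ cong (λ q → atDistance i (suc (suc q)) z) (Fin.toℕ-inject₁ j) ⟩
        atDistance i (suc (toℕ (suc j))) z
          ≡⟨ atDistance-tent i (suc j) z ⟩
        δᵛ (tent i (suc j)) z
          ≡⟨ idM-↔ _≟V_ (Enumeration._≟_ labels) colLabels (tent i (suc j)) z ⟨
        idM (Enumeration._≟_ labels) (inj₂ (Σ↔.to (i , j))) (colLabel z)
          ≡⟨ identity-block (colLabel z) ⟩
        T (inj₂ (Σ↔.to (i , j))) (colLabel z) ∎
        where
          open ≡-Reasoning
          identity-block : ∀ c → idM (Enumeration._≟_ labels) (inj₂ (Σ↔.to (i , j))) c ≡ T (inj₂ (Σ↔.to (i , j))) c
          identity-block (inj₁ _) = refl
          identity-block (inj₂ κ) = idM-resp (Enumeration._≟_ labels) _≟F_ inj₂-injective (cong inj₂)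

      C·L·Q : mul vs (mul vs C L) Q ≐ λ x z → sign (rowLabel x) * T (rowLabel x) (colLabel z)
      C·L·Q center z = begin
        ΣL vs (λ y → mul vs C L center y * Q y z)
          ≡⟨ ΣL-cong vs (λ y → cong (_* Q y z) (Vᴱ.sift center (λ u → L u y))) ⟩
        ΣL vs (λ y → L center y * Q y z)
          ≡⟨ near-center·Q (L center) (λ _ _ → refl) z ⟩
        L center z
          ≡⟨ center-row-of-L* z ⟩
        1ℤ * T (inj₁ (inj₂ tt)) (colLabel z) ∎
        where open ≡-Reasoning
      C·L·Q (tent i j) z with view j
      ... | ‵fromℕ = begin
        ΣL vs (λ y → ΣL vs (λ u → scaledKernel i u * L u y) * Q y z)
          ≡⟨ ΣL-cong vs (λ y → cong (_* Q y z) (leaf-combination i y)) ⟩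
        ΣL vs (λ y → T (inj₁ (inj₁ i)) (colLabel y) * Q y z)
          ≡⟨ near-center·Q (T (inj₁ (inj₁ i)) ∘ colLabel) (λ _ _ → refl) z ⟩
        T (inj₁ (inj₁ i)) (colLabel z)
          ≡⟨ *-identityˡ _ ⟨
        1ℤ * T (inj₁ (inj₁ i)) (colLabel z) ∎
        where open ≡-Reasoning
      ... | ‵inject₁ j′ = begin
        ΣL vs (λ y → ΣL vs (λ u → δᵛ x u * L u y) * Q y z)
          ≡⟨ ΣL-cong vs (λ y → cong (_* Q y z) (Vᴱ.sift x (λ u → L u y))) ⟩
        ΣL vs (λ y → L x y * Q y z)
          ≡⟨ L·Q-inner i (inject₁ j′) z (Fin.inject₁ℕ< j′) ⟩
        - atDistance i (suc (suc (toℕ (inject₁ j′)))) z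
          ≡⟨ cong -_ (inner-row-of-I i j′ z) ⟩
        - T (inj₂ (Σ↔.to (i , j′))) (colLabel z)
          ≡⟨ -1*i≡-i _ ⟨
        - 1ℤ * T (inj₂ (Σ↔.to (i , j′))) (colLabel z) ∎
        where open ≡-Reasoning
              x : V
              x = tent i (inject₁ j′)

      reduction : Equivalent vertices labels L T
      reduction = EquivZ-trans vertices vertices labels
        (C , C⁻¹ , Q , Q⁻¹ , C·C⁻¹ , C⁻¹·C , Q·Q⁻¹ , Q⁻¹·Q , C·L·Q)
        (relabel vertices labels rowLabels colLabels sign sign² (λ _ _ → refl))
        where
          C⁻¹ : Mat V V
          C⁻¹ = λ x y → δᵛ x y + (δᵛ x y - C x y)
          C·C⁻¹ : mul vs C C⁻¹ ≐ δᵛ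
          C·C⁻¹ = proj₁ (square-zero-inverse vertices C C-square-zero)
          C⁻¹·C : mul vs C⁻¹ C ≐ δᵛ
          C⁻¹·C = proj₂ (square-zero-inverse vertices C C-square-zero)
          sign² : ∀ κ → sign κ * sign κ ≡ 1ℤ
          sign² (inj₁ _) = refl
          sign² (inj₂ _) = refl

lemma6p3 : (ℓ : ℕ) → 3 ≤ ℓ → (m : Fin ℓ → ℕ) →
    (d r : Vtx ℓ m → ℕ) → (A : IsArithStructure ℓ m d r) →
    EquivZ (allVtx ℓ m) (enumT ℓ (nVtx ℓ m ∸ ℓ ∸ 1)) _≟V_ (decT ℓ (nVtx ℓ m ∸ ℓ ∸ 1))
      (LapM ℓ m d)
      (⊕I (decStar ℓ) (Lstar ℓ m d r (IsArithStructure.r-pos A)) (nVtx ℓ m ∸ ℓ ∸ 1))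
lemma6p3 ℓ _ m d r A = subst equivalent-with-identity-block (inner-vertex-count ℓ m) (reduction d r A)
  where
    equivalent-with-identity-block : ℕ → Set
    equivalent-with-identity-block K =
      EquivZ (allVtx ℓ m) (enumT ℓ K) _≟V_ (decT ℓ K) (LapM ℓ m d)
             (⊕I (decStar ℓ) (Lstar ℓ m d r (IsArithStructure.r-pos A)) K)
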